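{- Let $G$ be a finite simple graph with vertex weight function $\omega : V(G) \to \mathbb{N}$, and let $v, w$ be distinct vertices with $e = vw \notin E(G)$. Then \[ \overline{X}_{(G,\omega)} = \overline{X}_{(G/e,\, \omega/e)} + \overline{X}_{(G \cup e,\, \omega)} + \overline{X}_{(G^1,\, \omega^1)} + \overline{X}_{(G^2,\, \omega^2)} + \overline{X}_{(G^\star,\, \omega^\star)}. \]
   Context: $\mathbb{N}$ denotes the positive integers. For a finite simple graph $H$ with weight function $\omega : V(H) \to \mathbb{N}$, a proper set coloring is a map $\kappa$ assigning to each vertex $u$ a nonempty finite set $\kappa(u) \subseteq \mathbb{N}$ with $\kappa(u) \cap \kappa(u') = \emptyset$ whenever $uu' \in E(H)$, and $\overline{X}_{(H,\omega)} = \sum_\kappa \prod_{u \in V(H)} \big(\prod_{i \in \kappa(u)} x_i\big)^{\omega(u)}$, summed over all proper set colorings. Notation: $N(u) = \{u' : uu' \in E(G)\}$; for a vertex $u$ and set $S$ not containing $u$, $uS = \{us : s \in S\}$. - $G/e$: vertex set $(V(G) \setminus \{v,w\}) \cup \{z_{vw}\}$ for a new vertex $z_{vw}$, edge set $(E(G) \setminus (vN(v) \cup wN(w))) \cup z_{vw}N(v) \cup z_{vw}N(w)$; weight $(\omega/e)(z_{vw}) = \omega(v)+\omega(w)$ and $(\omega/e)(u) = \omega(u)$ otherwise. - $G \cup e$: vertex set $V(G)$, edge set $E(G) \cup \{vw\}$, weight $\omega$. - $G^1$: vertex set $V(G)$, edge set $E(G) \cup \{vw\} \cup vN(w)$; weight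 $\omega^1(v) = \omega(v)+\omega(w)$, $\omega^1(u) = \omega(u)$ otherwise. - $G^2$: vertex set $V(G)$, edge set $E(G) \cup \{vw\} \cup wN(v)$; weight $\omega^2(w) = \omega(v)+\omega(w)$, $\omega^2(u) = \omega(u)$ otherwise. - $G^\star$: vertex set $V(G) \cup \{z^\star\}$ for a new vertex $z^\star$, edge set $E(G) \cup \{vw, vz^\star, wz^\star\} \cup z^\star N(v) \cup z^\star N(w)$; weight $\omega^\star(z^\star) = \omega(v)+\omega(w)$, $\omega^\star(u) = \omega(u)$ for $u \in V(G)$. -}

module Defs where

open import Data.Nat using (ℕ; zero; suc; _+_; _≡ᵇ_)
open import Data.Bool using (Bool; true; false; _∧_; _∨_; not; if_then_else_)
open import Data.Fin using (Fin; zero; suc; punchIn; _≟_)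
open import Data.List using (List; []; _∷_; map; concatMap; length; filterᵇ; allFin)
open import Data.Bool.ListAction using (all; any)
open import Data.Nat.ListAction using (sum)
open import Relation.Nullary.Decidable using (⌊_⌋)

record WGraph : Set where
  constructor wgraph
  field
    n   : ℕ
    adj : Fin n → Fin n → Bool
    ω   : Fin n → ℕ
open WGraph public

allFns : {A : Set} → (k : ℕ) → List A → List (Fin k → A)
allFns zero    xs = (λ ()) ∷ []
allFns (suc k) xs =
  concatMap (λ a → map (λ f → λ { zero → a ; (suc i) → f i }) (allFns k xs)) xs

-- A "set coloring restricted to colours 1..N" : each vertex gets a subset
-- of Fin N, represented as its characteristic function.
Coloring : (n N : ℕ) → Set
Coloring n N = Fin n → Fin N → Bool

allColorings : (n N : ℕ) → List (Coloring n N)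
allColorings n N = allFns n (allFns N (true ∷ false ∷ []))

isProperSetColoring : (G : WGraph) (N : ℕ) → Coloring (n G) N → Bool
isProperSetColoring G N κ =
  all (λ u → any (λ i → κ u i) (allFin N)) (allFin (n G)) ∧
  all (λ a → all (λ b → not (adj G a b) ∨
         all (λ i → not (κ a i ∧ κ b i)) (allFin N)) (allFin (n G))) (allFin (n G))

-- κ contributes the monomial ∏_{i<N} x_{i+1}^{m i}
hasMonomial : (G : WGraph) (N : ℕ) → Coloring (n G) N → (Fin N → ℕ) → Bool
hasMonomial G N κ m =
  all (λ i → sum (map (λ u → if κ u i then ω G u else 0) (allFin (n G))) ≡ᵇ m i)
      (allFin N)

-- Coefficient of the monomial ∏_{i<N} x_{i+1}^{m i} in X̄_(G,ω).
-- With positive weights, any proper set coloring contributing to this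
-- monomial only uses colours in {1,…,N}, so this count is exactly the
-- coefficient. Two such power series are equal iff all coefficients agree.
Xcoeff : (G : WGraph) (N : ℕ) → (Fin N → ℕ) → ℕ
Xcoeff G N m =
  length (filterᵇ (λ κ → isProperSetColoring G N κ ∧ hasMonomial G N κ m)
                  (allColorings (n G) N))

_==_ : {k : ℕ} → Fin k → Fin k → Bool
a == b = ⌊ a ≟ b ⌋

module Ops (k : ℕ) (adj : Fin k → Fin k → Bool) (ω : Fin k → ℕ) (v w : Fin k) where
  pairvw : Fin k → Fin k → Bool
  pairvw a b = (a == v ∧ b == w) ∨ (a == w ∧ b == v)

  unionE : WGraph
  unionE = wgraph k (λ a b → adj a b ∨ pairvw a b) ω

  G1 : WGraph
  G1 = wgraph k
    (λ a b → adj a b ∨ pairvw a b ∨ (a == v ∧ adj w b) ∨ (b == v ∧ adj w a))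
    (λ a → if a == v then ω v + ω w else ω a)

  G2 : WGraph
  G2 = wgraph k
    (λ a b → adj a b ∨ pairvw a b ∨ (a == w ∧ adj v b) ∨ (b == w ∧ adj v a))
    (λ a → if a == w then ω v + ω w else ω a)

  -- G⋆ : vertex set Fin (suc k), new vertex z⋆ = zero, old vertex u = suc u
  zAdj : Fin k → Bool
  zAdj b = b == v ∨ b == w ∨ adj v b ∨ adj w b

  starAdj : Fin (suc k) → Fin (suc k) → Bool
  starAdj zero    zero    = false
  starAdj zero    (suc b) = zAdj b
  starAdj (suc a) zero    = zAdj a
  starAdj (suc a) (suc b) = adj a b ∨ pairvw a b

  starω : Fin (suc k) → ℕ
  starω zero    = ω v + ω w
  starω (suc a) = ω a

  Gstar : WGraph
  Gstar = wgraph (suc k) starAdj starω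

-- G/e for a graph on Fin (suc k): vertex w is deleted (remaining vertices
-- are indexed by Fin k via punchIn w), and v plays the role of the new
-- vertex z_vw, adjacent to N(v) ∪ N(w), with weight ω v + ω w.
contract : (k : ℕ) (adj : Fin (suc k) → Fin (suc k) → Bool) (ω : Fin (suc k) → ℕ)
           (v w : Fin (suc k)) → WGraph
contract k adj ω v w = wgraph k cadj cω
  where
  orig : Fin k → Fin (suc k)
  orig = punchIn w
  isZ : Fin k → Bool
  isZ a = orig a == v
  cadj : Fin k → Fin k → Bool
  cadj a b = adj (orig a) (orig b) ∨ (isZ a ∧ adj w (orig b)) ∨ (isZ b ∧ adj (orig a) w)
  cω : Fin k → ℕ
  cω a = if isZ a then ω v + ω w else ω (orig a)

module Submission where

-- Split the proper set colorings κ of (G, ω) by how the colour sets κ v and κ w overlap, and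
-- match each class bijectively, preserving the monomial, with the proper set colorings of one
-- of the five graphs:
--   disjoint      — κ itself colours G ∪ e;
--   equal         — the common set colours z_vw, a proper colouring of G/e;
--   κ v ⊊ κ w     — give w the set κ w ∖ κ v; then v must avoid w and N(w), and carries the
--                   weight ω v + ω w of every colour it holds, which is G¹ (symmetrically G²);
--   crossing      — move κ v ∩ κ w to the new vertex z⋆ adjacent to v, w, N(v), N(w), and keep
--                   κ v ∖ κ w on v and κ w ∖ κ v on w, which is G⋆.

open import Defs
open import Data.Bool using (Bool; true; false; T; _∧_; _∨_; not; if_then_else_)
open import Data.Bool.ListAction using (all; any)
open import Data.Bool.Properties using (T-∧; T-∨)
import Data.Bool.Properties as Bool
open import Data.Empty using (⊥)
open import Data.Fin using (Fin; zero; suc; punchIn; punchOut)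
open import Data.Fin.Properties using (_≟_; all?; ¬∀⟶∃¬; punchInᵢ≢i; punchIn-punchOut; punchIn-injective)
open import Data.List using (List; []; _∷_; _++_; map; concatMap; length; filter; allFin)
import Data.List as List
open import Data.List.Membership.Propositional using (lose)
open import Data.List.Membership.Propositional.Properties using (∈-allFin)
open import Data.List.Properties using (map-++; map-cong; map-∘; map-tabulate; filter-none)
open import Data.List.Relation.Unary.All using (universal)
import Data.List.Relation.Unary.All as All
open import Data.List.Relation.Unary.All.Properties using (all⁺; all⁻)
import Data.List.Relation.Unary.Any as Any
open import Data.List.Relation.Unary.Any.Properties using (any⁺; any⁻)
open import Data.Nat using (ℕ; zero; suc; _+_; _≤_; _≡ᵇ_)
open import Data.Nat.ListAction using (sum)
open import Data.Nat.ListAction.Properties using (sum-++)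
open import Data.Nat.Properties using (+-assoc; +-comm; +-identityʳ; +-suc; ≡ᵇ⇒≡; ≡⇒≡ᵇ; +-0-commutativeMonoid)
open import Data.Nat.Tactic.RingSolver using (solve-∀)
open import Data.Product using (_×_; _,_; proj₁; proj₂; ∃)
import Data.Product as Product
open import Data.Sum using (_⊎_; inj₁; inj₂)
import Data.Sum as Sum
open import Data.Vec.Functional using (Vector; updateAt; removeAt; insertAt; tail)
import Data.Vec.Functional as Vector
open import Data.Vec.Functional.Properties
  using (updateAt-updates; updateAt-minimal; removeAt-punchOut; insertAt-lookup; insertAt-punchIn; removeAt-insertAt)
import Data.Vec.Functional.Relation.Binary.Pointwise.Properties as Pointwise
open import Function using (_∘_; _⇔_; mk⇔; Equivalence)
open import Level using (0ℓ)
open import Relation.Binary using (DecSetoid; _Respects_)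
open import Relation.Binary.PropositionalEquality
open import Relation.Nullary using (Dec; yes; no; does; ¬_; contradiction; _×-dec_; _→-dec_; ¬?)
open import Relation.Nullary.Decidable
  using (does-⇔; dec-true; dec-false; toSum; T?; decidable-stable; ⌊_⌋; toWitness; fromWitness)
import Relation.Nullary.Decidable as Dec
open import Relation.Unary using (Pred; Decidable; _∩_; ∁)
open import Relation.Unary.Properties using (_∩?_; ∁?)
import Algebra.Properties.CommutativeMonoid.Sum +-0-commutativeMonoid as ℕSum

open ≡-Reasoning

private variable
  A B : Set

module ⇔ = Equivalence

iverson : Bool → ℕ
iverson b = if b then 1 else 0

count : {P : Pred A 0ℓ} → Decidable P → List A → ℕ
count P? xs = length (filter P? xs)

module _ {P : Pred A 0ℓ} (P? : Decidable P) where

  count≡sum : ∀ xs → count P? xs ≡ sum (map (iverson ∘ does ∘ P?) xs)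
  count≡sum []       = refl
  count≡sum (x ∷ xs) with does (P? x)
  ... | true  = cong suc (count≡sum xs)
  ... | false = count≡sum xs

  count-none : ∀ xs → (∀ x → ¬ P x) → count P? xs ≡ 0
  count-none xs ¬P = cong length (filter-none P? (universal ¬P xs))

module _ {P Q : Pred A 0ℓ} (P? : Decidable P) (Q? : Decidable Q) where

  count-cong : ∀ xs → (∀ x → P x ⇔ Q x) → count P? xs ≡ count Q? xs
  count-cong xs P⇔Q = begin
    count P? xs
      ≡⟨ count≡sum P? xs ⟩
    sum (map (iverson ∘ does ∘ P?) xs)
      ≡⟨ cong sum (map-cong (λ x → cong iverson (does-⇔ (P⇔Q x) (P? x) (Q? x))) xs) ⟩
    sum (map (iverson ∘ does ∘ Q?) xs)
      ≡⟨ count≡sum Q? xs ⟨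
    count Q? xs ∎

  count-split : ∀ xs → count P? xs ≡ count (P? ∩? Q?) xs + count (P? ∩? ∁? Q?) xs
  count-split []       = refl
  count-split (x ∷ xs) with does (P? x) | does (Q? x)
  ... | false | _     = count-split xs
  ... | true  | true  = cong suc (count-split xs)
  ... | true  | false = trans (cong suc (count-split xs)) (sym (+-suc _ _))

module _ {P S Q R : Pred A 0ℓ} (P? : Decidable P) (S? : Decidable S) (Q? : Decidable Q) (R? : Decidable R) where
  private
    P∖S? : Decidable (P ∩ ∁ S)
    P∖S? = P? ∩? ∁? S?

  count-split₃ : ∀ xs → count P? xs ≡ count (P? ∩? S?) xs +
                   ((count ((P∖S? ∩? Q?) ∩? R?) xs + count ((P∖S? ∩? Q?) ∩? ∁? R?) xs) +
                    (count ((P∖S? ∩? ∁? Q?) ∩? R?) xs + count ((P∖S? ∩? ∁? Q?) ∩? ∁? R?) xs))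
  count-split₃ xs = trans (count-split P? S? xs) (cong (count (P? ∩? S?) xs +_)
    (trans (count-split P∖S? Q? xs) (cong₂ _+_ (count-split (P∖S? ∩? Q?) R? xs) (count-split (P∖S? ∩? ∁? Q?) R? xs))))

sum-map-concatMap : (f : B → ℕ) (F : A → List B) (xs : List A) →
                    sum (map f (concatMap F xs)) ≡ sum (map (λ x → sum (map f (F x))) xs)
sum-map-concatMap f F []       = refl
sum-map-concatMap f F (x ∷ xs) = begin
  sum (map f (F x ++ concatMap F xs))
    ≡⟨ cong sum (map-++ f (F x) _) ⟩
  sum (map f (F x) ++ map f (concatMap F xs))
    ≡⟨ sum-++ (map f (F x)) _ ⟩
  sum (map f (F x)) + sum (map f (concatMap F xs))
    ≡⟨ cong (sum (map f (F x)) +_) (sum-map-concatMap f F xs) ⟩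
  sum (map f (F x)) + sum (map (λ x → sum (map f (F x))) xs)  ∎

sum-map-zero : {f : A → ℕ} (xs : List A) → (∀ x → f x ≡ 0) → sum (map f xs) ≡ 0
sum-map-zero []       f≡0 = refl
sum-map-zero (x ∷ xs) f≡0 = cong₂ _+_ (f≡0 x) (sum-map-zero xs f≡0)

sum-map≡∑ : (f : A → ℕ) (xs : List A) → sum (map f xs) ≡ ℕSum.sum (f ∘ List.lookup xs)
sum-map≡∑ f []       = refl
sum-map≡∑ f (x ∷ xs) = cong (f x +_) (sum-map≡∑ f xs)

sum-map-comm : {A B : Set} (F : A → B → ℕ) (xs : List A) (ys : List B) →
               sum (map (λ x → sum (map (F x) ys)) xs) ≡ sum (map (λ y → sum (map (λ x → F x y) xs)) ys)
sum-map-comm {A} {B} F xs ys = begin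
  sum (map (λ x → sum (map (F x) ys)) xs)
    ≡⟨ sum-map≡∑ _ xs ⟩
  ℕSum.sum (λ i → sum (map (F (x i)) ys))
    ≡⟨ ℕSum.sum-cong-≗ (λ i → sum-map≡∑ (F (x i)) ys) ⟩
  ℕSum.sum (λ i → ℕSum.sum (λ j → F (x i) (y j)))
    ≡⟨ ℕSum.∑-comm (λ i j → F (x i) (y j)) ⟩
  ℕSum.sum (λ j → ℕSum.sum (λ i → F (x i) (y j)))
    ≡⟨ ℕSum.sum-cong-≗ (λ j → sum-map≡∑ (λ x → F x (y j)) xs) ⟨
  ℕSum.sum (λ j → sum (map (λ x → F x (y j)) xs))
    ≡⟨ sum-map≡∑ _ ys ⟨
  sum (map (λ y → sum (map (λ x → F x y) xs)) ys)          ∎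
  where
  x : Fin (length xs) → A
  x = List.lookup xs
  y : Fin (length ys) → B
  y = List.lookup ys

module _ (S : DecSetoid 0ℓ 0ℓ) where
  open DecSetoid S using (Carrier) renaming (_≟_ to _≈?_)

  Enumerates : List Carrier → Set
  Enumerates xs = ∀ x → count (x ≈?_) xs ≡ 1

module _ {S : DecSetoid 0ℓ 0ℓ} {xs : List (DecSetoid.Carrier S)} (xs-enum : Enumerates S xs) where
  open DecSetoid S using (Carrier; _≈_) renaming (_≟_ to _≈?_)

  private
    Fns : ℕ → DecSetoid 0ℓ 0ℓ
    Fns = Pointwise.decSetoid S

  allFns-enumerates : ∀ k → Enumerates (Fns k) (allFns k xs)
  allFns-enumerates zero    f =
    cong (λ b → iverson b + 0) (dec-true (DecSetoid._≟_ (Fns 0) f (λ ())) (λ ()))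
  allFns-enumerates (suc k) f = extensions-enumerate _ (λ _ _ → refl) (λ _ _ _ → refl)
    where
    _≈?ₖ₊₁_ : (g h : Vector Carrier (suc k)) → Dec (∀ i → g i ≈ h i)
    _≈?ₖ₊₁_ = DecSetoid._≟_ (Fns (suc k))
    _≈?ₖ_ : (g h : Vector Carrier k) → Dec (∀ i → g i ≈ h i)
    _≈?ₖ_ = DecSetoid._≟_ (Fns k)

    -- c stands for the extension λ { zero → a ; (suc i) → g i } used by allFns, a pattern lambda
    -- that cannot be named outside Defs.
    extensions : ∀ a {c : Vector Carrier k → Vector Carrier (suc k)} →
                 (∀ g → c g zero ≡ a) → (∀ g i → c g (suc i) ≡ g i) →
                 sum (map (iverson ∘ does ∘ (f ≈?ₖ₊₁_) ∘ c) (allFns k xs)) ≡ iverson (does (f zero ≈? a))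
    extensions a {c} c-zero c-suc with f zero ≈? a
    ... | yes f₀≈a = begin
      sum (map (iverson ∘ does ∘ (f ≈?ₖ₊₁_) ∘ c) (allFns k xs))
        ≡⟨ cong sum (map-cong (λ g → cong iverson (does-⇔ (tails g) (f ≈?ₖ₊₁ c g) ((f ∘ suc) ≈?ₖ g))) (allFns k xs)) ⟩
      sum (map (iverson ∘ does ∘ ((f ∘ suc) ≈?ₖ_)) (allFns k xs))
        ≡⟨ count≡sum ((f ∘ suc) ≈?ₖ_) (allFns k xs) ⟨
      count ((f ∘ suc) ≈?ₖ_) (allFns k xs)
        ≡⟨ allFns-enumerates k (f ∘ suc) ⟩
      1 ∎
      where
      tails : ∀ g → (∀ i → f i ≈ c g i) ⇔ (∀ i → f (suc i) ≈ g i)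
      tails g = mk⇔ (λ f≈cg i → subst (f (suc i) ≈_) (c-suc g i) (f≈cg (suc i)))
                    (λ { f≈g zero → subst (f zero ≈_) (sym (c-zero g)) f₀≈a
                       ; f≈g (suc i) → subst (f (suc i) ≈_) (sym (c-suc g i)) (f≈g i) })
    ... | no f₀≉a = sum-map-zero (allFns k xs) λ g →
      cong iverson (dec-false (f ≈?ₖ₊₁ c g) (λ f≈cg → f₀≉a (subst (f zero ≈_) (c-zero g) (f≈cg zero))))

    extensions-enumerate : (c : Carrier → Vector Carrier k → Vector Carrier (suc k)) →
                           (∀ a g → c a g zero ≡ a) → (∀ a g i → c a g (suc i) ≡ g i) →
                           count (f ≈?ₖ₊₁_) (concatMap (λ a → map (c a) (allFns k xs)) xs) ≡ 1
    extensions-enumerate c c-zero c-suc = begin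
      count (f ≈?ₖ₊₁_) (concatMap (λ a → map (c a) (allFns k xs)) xs)
        ≡⟨ count≡sum (f ≈?ₖ₊₁_) (concatMap (λ a → map (c a) (allFns k xs)) xs) ⟩
      sum (map (iverson ∘ does ∘ (f ≈?ₖ₊₁_)) (concatMap (λ a → map (c a) (allFns k xs)) xs))
        ≡⟨ sum-map-concatMap _ _ xs ⟩
      sum (map (λ a → sum (map (iverson ∘ does ∘ (f ≈?ₖ₊₁_)) (map (c a) (allFns k xs)))) xs)
        ≡⟨ cong sum (map-cong (λ a → trans (cong sum (sym (map-∘ (allFns k xs))))
                                           (extensions a {c a} (c-zero a) (c-suc a))) xs) ⟩
      sum (map (iverson ∘ does ∘ (f zero ≈?_)) xs)
        ≡⟨ count≡sum (f zero ≈?_) xs ⟨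
      count (f zero ≈?_) xs
        ≡⟨ xs-enum (f zero) ⟩
      1 ∎

module _ (S T : DecSetoid 0ℓ 0ℓ) where
  private
    module S = DecSetoid S
    module T = DecSetoid T

  record InverseOn (P : Pred S.Carrier 0ℓ) (Q : Pred T.Carrier 0ℓ) : Set where
    field
      to        : S.Carrier → T.Carrier
      from      : T.Carrier → S.Carrier
      to-cong   : ∀ {x x′} → x S.≈ x′ → to x T.≈ to x′
      from-cong : ∀ {y y′} → y T.≈ y′ → from y S.≈ from y′
      to-∈      : ∀ {x} → P x → Q (to x)
      from-∈    : ∀ {y} → Q y → P (from y)
      from∘to   : ∀ {x} → P x → from (to x) S.≈ x
      to∘from   : ∀ {y} → Q y → to (from y) T.≈ y

  module _ {P Q} (P? : Decidable P) (Q? : Decidable Q)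
           (P-resp : P Respects S._≈_) (Q-resp : Q Respects T._≈_) (inv : InverseOn P Q)
           {xs ys} (xs-enum : Enumerates S xs) (ys-enum : Enumerates T ys) where
    open InverseOn inv

    private
      Incident : S.Carrier → T.Carrier → Set
      Incident x y = P x × to x T.≈ y

      incident? : ∀ x y → Dec (Incident x y)
      incident? x y = P? x ×-dec (to x T.≟ y)

      row : ∀ x → count (incident? x) ys ≡ iverson (does (P? x))
      row x with toSum (P? x)
      ... | inj₁ px  = begin
        count (incident? x) ys    ≡⟨ count-cong (incident? x) (to x T.≟_) ys (λ y → mk⇔ proj₂ (px ,_)) ⟩
        count (to x T.≟_) ys      ≡⟨ ys-enum (to x) ⟩
        1                         ≡⟨ cong iverson (dec-true (P? x) px) ⟨
        iverson (does (P? x))     ∎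
      ... | inj₂ ¬px = trans (count-none (incident? x) ys (λ y → ¬px ∘ proj₁))
                             (cong iverson (sym (dec-false (P? x) ¬px)))

      column : ∀ y → count (λ x → incident? x y) xs ≡ iverson (does (Q? y))
      column y with toSum (Q? y)
      ... | inj₁ qy = begin
        count (λ x → incident? x y) xs
          ≡⟨ count-cong (λ x → incident? x y) (from y S.≟_) xs (λ x → mk⇔ incident⇒ ⇒incident) ⟩
        count (from y S.≟_) xs
          ≡⟨ xs-enum (from y) ⟩
        1
          ≡⟨ cong iverson (dec-true (Q? y) qy) ⟨
        iverson (does (Q? y))            ∎
        where
        incident⇒ : ∀ {x} → Incident x y → from y S.≈ x
        incident⇒ (px , tx≈y) = S.trans (from-cong (T.sym tx≈y)) (from∘to px)
        ⇒incident : ∀ {x} → from y S.≈ x → Incident x y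
        ⇒incident fy≈x = P-resp fy≈x (from-∈ qy) , T.trans (to-cong (S.sym fy≈x)) (to∘from qy)
      ... | inj₂ ¬qy = trans (count-none (λ x → incident? x y) xs (λ x (px , tx≈y) → ¬qy (Q-resp tx≈y (to-∈ px))))
                             (cong iverson (sym (dec-false (Q? y) ¬qy)))

    -- Double counting of the pairs (x , y) with P x and to x ≈ y.
    count-InverseOn : count P? xs ≡ count Q? ys
    count-InverseOn = begin
      count P? xs
        ≡⟨ count≡sum P? xs ⟩
      sum (map (iverson ∘ does ∘ P?) xs)
        ≡⟨ cong sum (map-cong rowsum xs) ⟨
      sum (map (λ x → sum (map (λ y → iverson (does (incident? x y))) ys)) xs)
        ≡⟨ sum-map-comm (λ x y → iverson (does (incident? x y))) xs ys ⟩
      sum (map (λ y → sum (map (λ x → iverson (does (incident? x y))) xs)) ys)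
        ≡⟨ cong sum (map-cong columnsum ys) ⟩
      sum (map (iverson ∘ does ∘ Q?) ys)
        ≡⟨ count≡sum Q? ys ⟨
      count Q? ys ∎
      where
      rowsum : ∀ x → sum (map (λ y → iverson (does (incident? x y))) ys) ≡ iverson (does (P? x))
      rowsum x = trans (sym (count≡sum (incident? x) ys)) (row x)
      columnsum : ∀ y → sum (map (λ x → iverson (does (incident? x y))) xs) ≡ iverson (does (Q? y))
      columnsum y = trans (sym (count≡sum (λ x → incident? x y) xs)) (column y)

T-does : {X : Set} (x? : Dec X) → T (does x?) ⇔ X
T-does (yes x) = mk⇔ (λ _ → x) (λ _ → _)
T-does (no ¬x) = mk⇔ (λ ()) ¬x

T-not : ∀ {b} → T (not b) ⇔ (¬ T b)
T-not {b} = T-does (¬? (T? b))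

T-⇒ : ∀ {b c} → T (not b ∨ c) ⇔ (T b → T c)
T-⇒ {b} {c} = T-does (T? b →-dec T? c)

T-nand : ∀ {b c} → T (not (b ∧ c)) ⇔ (¬ (T b × T c))
T-nand {b} {c} = T-does (¬? (T? b ×-dec T? c))

T-¬→ : ∀ {x y} → ¬ (T x → T y) → T x × ¬ T y
T-¬→ {true}  ¬x→y = _ , λ y → ¬x→y (λ _ → y)
T-¬→ {false} ¬x→y = contradiction (λ ()) ¬x→y

T-injective : ∀ {x y} → T x ⇔ T y → x ≡ y
T-injective {true}  {true}  _   = refl
T-injective {true}  {false} x⇔y = contradiction (⇔.to x⇔y _) λ ()
T-injective {false} {true}  x⇔y = contradiction (⇔.from x⇔y _) λ ()
T-injective {false} {false} _   = refl

split-weight : ∀ x a b → (if x then a + b else 0) ≡ (if x then b else 0) + (if x then a else 0)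
split-weight true  a b = +-comm a b
split-weight false a b = refl

restore-∧-not : ∀ x y → (T y → T x) → (x ∧ not y) ∨ y ≡ x
restore-∧-not true  y     _   = Bool.∨-inverseˡ y
restore-∧-not false true  y⇒x = contradiction (y⇒x _) λ ()
restore-∧-not false false _   = refl

remove-∨ : ∀ x y → ¬ (T x × T y) → (x ∨ y) ∧ not y ≡ x
remove-∨ true  true  ¬both = contradiction (_ , _) ¬both
remove-∨ true  false _     = refl
remove-∨ false y     _     = Bool.∧-inverseʳ y

merged-weight : ∀ x y a b → (T x → T y) →
                (if x then a + b else 0) + (if y ∧ not x then b else 0) ≡ (if x then a else 0) + (if y then b else 0)
merged-weight true  true  a b _   = +-identityʳ (a + b)
merged-weight true  false a b x⇒y = contradiction (x⇒y _) λ ()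
merged-weight false y     a b _   = cong (λ z → if z then b else 0) (Bool.∧-identityʳ y)

shared-weight : ∀ x y a b →
  (if x ∧ y then a + b else 0) + ((if x ∧ not y then a else 0) + (if y ∧ not x then b else 0))
  ≡ (if x then a else 0) + (if y then b else 0)
shared-weight true  true  a b = +-identityʳ (a + b)
shared-weight true  false a b = refl
shared-weight false true  a b = refl
shared-weight false false a b = refl

rejoinˡ : ∀ x y → (x ∧ not y) ∨ (x ∧ y) ≡ x
rejoinˡ true  true  = refl
rejoinˡ true  false = refl
rejoinˡ false _     = refl

rejoinʳ : ∀ x y → (y ∧ not x) ∨ (x ∧ y) ≡ y
rejoinʳ x y = trans (cong ((y ∧ not x) ∨_) (Bool.∧-comm x y)) (rejoinˡ y x)

common-part : ∀ x y z → ¬ (T x × T y) → (x ∨ z) ∧ (y ∨ z) ≡ z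
common-part true  true  z     ¬both = contradiction (_ , _) ¬both
common-part true  false z     _     = refl
common-part false true  true  _     = refl
common-part false true  false _     = refl
common-part false false z     _     = Bool.∧-idem z

own-part : ∀ x y z → ¬ (T x × T y) → ¬ (T x × T z) → (x ∨ z) ∧ not (y ∨ z) ≡ x
own-part true  true  z     ¬xy _   = contradiction (_ , _) ¬xy
own-part true  false true  _   ¬xz = contradiction (_ , _) ¬xz
own-part true  false false _   _   = refl
own-part false y     true  _   _   = cong not (Bool.∨-zeroʳ y)
own-part false y     false _   _   = refl

module _ {n : ℕ} where

  T-all-allFin : {p : Fin n → Bool} {P : Fin n → Set} → (∀ i → T (p i) ⇔ P i) → T (all p (allFin n)) ⇔ (∀ i → P i)
  T-all-allFin {p} p⇔P = mk⇔
    (λ t i → ⇔.to (p⇔P i) (All.lookup (all⁺ p _ t) (∈-allFin i)))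
    (λ h → all⁻ p {allFin n} (universal (λ i → ⇔.from (p⇔P i) (h i)) (allFin n)))

  T-any-allFin : (p : Fin n → Bool) → T (any p (allFin n)) ⇔ ∃ (T ∘ p)
  T-any-allFin p = mk⇔ (Any.satisfied ∘ any⁻ p (allFin n)) (λ (i , pi) → any⁺ {xs = allFin n} p (lose (∈-allFin i) pi))

  sum-map-allFin : (f : Fin n → ℕ) → sum (map f (allFin n)) ≡ ℕSum.sum f
  sum-map-allFin f = trans (cong sum (map-tabulate (λ i → i) f)) (sum-tabulate f)
    where
    sum-tabulate : ∀ {k} (g : Fin k → ℕ) → sum (List.tabulate g) ≡ ℕSum.sum g
    sum-tabulate {zero}  g = refl
    sum-tabulate {suc k} g = cong (g zero +_) (sum-tabulate (g ∘ suc))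

sum-removeAt-cong : ∀ {n} {F F′ : Fin (suc n) → ℕ} v → (∀ u → u ≢ v → F u ≡ F′ u) →
                    ℕSum.sum (removeAt F v) ≡ ℕSum.sum (removeAt F′ v)
sum-removeAt-cong v agree = ℕSum.sum-cong-≗ (λ j → agree (punchIn v j) (punchInᵢ≢i v j))

sum-local₁ : ∀ {n} {F F′ : Fin n → ℕ} {c} v → (∀ u → u ≢ v → F u ≡ F′ u) →
             F′ v ≡ c + F v → ℕSum.sum F′ ≡ c + ℕSum.sum F
sum-local₁ {suc n} {F} {F′} {c} v agree F′v≡c+Fv = begin
  ℕSum.sum F′                                ≡⟨ ℕSum.sum-remove F′ ⟩
  F′ v + ℕSum.sum (removeAt F′ v)            ≡⟨ cong₂ _+_ F′v≡c+Fv (sym (sum-removeAt-cong v agree)) ⟩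
  (c + F v) + ℕSum.sum (removeAt F v)        ≡⟨ +-assoc c (F v) _ ⟩
  c + (F v + ℕSum.sum (removeAt F v))        ≡⟨ cong (c +_) (ℕSum.sum-remove F) ⟨
  c + ℕSum.sum F ∎

sum-local₂ : ∀ {n} {F F′ : Fin n → ℕ} {c} {v w} → v ≢ w → (∀ u → u ≢ v → u ≢ w → F u ≡ F′ u) →
             c + (F′ v + F′ w) ≡ F v + F w → c + ℕSum.sum F′ ≡ ℕSum.sum F
sum-local₂ {suc zero} {v = zero} {zero} v≢w = contradiction refl v≢w
sum-local₂ {suc (suc n)} {F} {F′} {c} {v} {w} v≢w agree pair = begin
  c + ℕSum.sum F′
    ≡⟨ cong (c +_) (ℕSum.sum-remove F′) ⟩
  c + (F′ v + ℕSum.sum (removeAt F′ v))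
    ≡⟨ cong (λ s → c + (F′ v + s)) (ℕSum.sum-remove (removeAt F′ v)) ⟩
  c + (F′ v + (removeAt F′ v j + ℕSum.sum rest′))
    ≡⟨ cong (λ s → c + (F′ v + (s + ℕSum.sum rest′))) (removeAt-punchOut F′ v≢w) ⟩
  c + (F′ v + (F′ w + ℕSum.sum rest′))
    ≡⟨ regroup ⟩
  (c + (F′ v + F′ w)) + ℕSum.sum rest′
    ≡⟨ cong₂ _+_ pair (sym (sum-removeAt-cong j agree-off-j)) ⟩
  (F v + F w) + ℕSum.sum rest
    ≡⟨ +-assoc (F v) (F w) _ ⟩
  F v + (F w + ℕSum.sum rest)
    ≡⟨ cong (λ s → F v + (s + ℕSum.sum rest)) (removeAt-punchOut F v≢w) ⟨
  F v + (removeAt F v j + ℕSum.sum rest)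
    ≡⟨ cong (F v +_) (ℕSum.sum-remove (removeAt F v)) ⟨
  F v + ℕSum.sum (removeAt F v)
    ≡⟨ ℕSum.sum-remove F ⟨
  ℕSum.sum F ∎
  where
  j : Fin (suc n)
  j = punchOut v≢w
  rest rest′ : Fin n → ℕ
  rest  = removeAt (removeAt F v) j
  rest′ = removeAt (removeAt F′ v) j
  agree-off-j : ∀ b → b ≢ j → removeAt F v b ≡ removeAt F′ v b
  agree-off-j b b≢j = agree (punchIn v b) (punchInᵢ≢i v b)
    (λ eq → b≢j (punchIn-injective v b j (trans eq (sym (punchIn-punchOut v≢w)))))
  regroup : c + (F′ v + (F′ w + ℕSum.sum rest′)) ≡ (c + (F′ v + F′ w)) + ℕSum.sum rest′
  regroup = trans (cong (c +_) (sym (+-assoc (F′ v) (F′ w) _))) (sym (+-assoc c _ _))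

module _ {k : ℕ} where

  ==-refl : (a : Fin k) → (a == a) ≡ true
  ==-refl a = cong ⌊_⌋ (≡-≟-identity _≟_ refl)

  ==-≢ : {a b : Fin k} → a ≢ b → (a == b) ≡ false
  ==-≢ a≢b = cong ⌊_⌋ (≢-≟-identity _≟_ a≢b)

  T-== : {a b : Fin k} → T (a == b) → a ≡ b
  T-== = toWitness

data PunchView {n : ℕ} (i : Fin (suc n)) : Fin (suc n) → Set where
  pivot   : PunchView i i
  punched : (j : Fin n) → PunchView i (punchIn i j)

punchView : ∀ {n} (i j : Fin (suc n)) → PunchView i j
punchView i j with i ≟ j
... | yes refl = pivot
... | no i≢j   = subst (PunchView i) (punchIn-punchOut i≢j) (punched (punchOut i≢j))

data Position {n : ℕ} (v w : Fin n) : Fin n → Set where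
  at-v      : Position v w v
  at-w      : Position v w w
  elsewhere : ∀ {u} → u ≢ v → u ≢ w → Position v w u

position : ∀ {n} (v w u : Fin n) → Position v w u
position v w u with u ≟ v | u ≟ w
... | yes refl | _        = at-v
... | no _     | yes refl = at-w
... | no u≢v   | no u≢w   = elsewhere u≢v u≢w

module _ {A : Set} {n : ℕ} {v w : Fin n} (v≢w : v ≢ w) (xs : Fin n → A) (f g : A → A) where

  updateAt₂-v : updateAt (updateAt xs v f) w g v ≡ f (xs v)
  updateAt₂-v = trans (updateAt-minimal v w _ v≢w) (updateAt-updates v xs)

  updateAt₂-w : updateAt (updateAt xs v f) w g w ≡ g (xs w)
  updateAt₂-w = trans (updateAt-updates w _) (cong g (updateAt-minimal w v xs (v≢w ∘ sym)))

  updateAt₂-other : ∀ {u} → u ≢ v → u ≢ w → updateAt (updateAt xs v f) w g u ≡ xs u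
  updateAt₂-other u≢v u≢w = trans (updateAt-minimal _ w _ u≢w) (updateAt-minimal _ v xs u≢v)

ColorSet : ℕ → Set
ColorSet N = Fin N → Bool

module _ {N : ℕ} where

  _⊆_ : ColorSet N → ColorSet N → Set
  S ⊆ S′ = ∀ i → T (S i) → T (S′ i)

  Disjoint : ColorSet N → ColorSet N → Set
  Disjoint S S′ = ∀ i → ¬ (T (S i) × T (S′ i))

  NonEmpty : ColorSet N → Set
  NonEmpty S = ∃ λ i → T (S i)

  _⊆?_ : (S S′ : ColorSet N) → Dec (S ⊆ S′)
  S ⊆? S′ = all? λ i → T? (S i) →-dec T? (S′ i)

  disjoint? : (S S′ : ColorSet N) → Dec (Disjoint S S′)
  disjoint? S S′ = all? λ i → ¬? (T? (S i) ×-dec T? (S′ i))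

  ⊆-resp : {S₁ S₂ S₁′ S₂′ : ColorSet N} → (∀ i → S₁ i ≡ S₂ i) → (∀ i → S₁′ i ≡ S₂′ i) → S₁ ⊆ S₁′ → S₂ ⊆ S₂′
  ⊆-resp S₁≗S₂ S₁′≗S₂′ S₁⊆S₁′ i = subst T (S₁′≗S₂′ i) ∘ S₁⊆S₁′ i ∘ subst T (sym (S₁≗S₂ i))

  Disjoint-resp : {S₁ S₂ S₁′ S₂′ : ColorSet N} → (∀ i → S₁ i ≡ S₂ i) → (∀ i → S₁′ i ≡ S₂′ i) → Disjoint S₁ S₁′ → Disjoint S₂ S₂′
  Disjoint-resp S₁≗S₂ S₁′≗S₂′ d i (x , y) = d i (subst T (sym (S₁≗S₂ i)) x , subst T (sym (S₁′≗S₂′ i)) y)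

  Disjoint-sym : {S S′ : ColorSet N} → Disjoint S S′ → Disjoint S′ S
  Disjoint-sym d i (x , y) = d i (y , x)

  ¬⊆-witness : {S S′ : ColorSet N} → ¬ S ⊆ S′ → ∃ λ i → T (S i) × ¬ T (S′ i)
  ¬⊆-witness {S} {S′} S⊈S′ = Product.map₂ T-¬→ (¬∀⟶∃¬ N _ (λ i → T? (S i) →-dec T? (S′ i)) S⊈S′)

  ¬Disjoint-witness : {S S′ : ColorSet N} → ¬ Disjoint S S′ → ∃ λ i → T (S i) × T (S′ i)
  ¬Disjoint-witness {S} {S′} ¬d =
    Product.map₂ (decidable-stable (T? _ ×-dec T? _)) (¬∀⟶∃¬ N _ (λ i → ¬? (T? (S i) ×-dec T? (S′ i))) ¬d)

-- Without function extensionality, allColorings lists every coloring exactly once only up to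
-- pointwise equality, so colorings are counted in this setoid.
Colorings : ℕ → ℕ → DecSetoid 0ℓ 0ℓ
Colorings n N = Pointwise.decSetoid (Pointwise.decSetoid Bool.≡-decSetoid N) n

allColorings-enumerates : ∀ n N → Enumerates (Colorings n N) (allColorings n N)
allColorings-enumerates n N =
  allFns-enumerates {S = Pointwise.decSetoid Bool.≡-decSetoid N} (allFns-enumerates {S = Bool.≡-decSetoid} booleans N) n
  where
  booleans : Enumerates Bool.≡-decSetoid (true ∷ false ∷ [])
  booleans true  = refl
  booleans false = refl

module _ {n N : ℕ} where
  record IsProper (adj : Fin n → Fin n → Bool) (κ : Coloring n N) : Set where
    field
      nonEmpty : ∀ u → NonEmpty (κ u)
      disjoint : ∀ {a b} → T (adj a b) → Disjoint (κ a) (κ b)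

  weight : (Fin n → ℕ) → Coloring n N → Fin N → ℕ
  weight ω κ i = ℕSum.sum (λ u → if κ u i then ω u else 0)

  weight-cong : ∀ ω {κ κ′} → (∀ u i → κ u i ≡ κ′ u i) → ∀ i → weight ω κ i ≡ weight ω κ′ i
  weight-cong ω κ≈κ′ i = ℕSum.sum-cong-≗ (λ u → cong (λ b → if b then ω u else 0) (κ≈κ′ u i))

  HasMonomial : (Fin n → ℕ) → (Fin N → ℕ) → Coloring n N → Set
  HasMonomial ω m κ = ∀ i → weight ω κ i ≡ m i

IsProper-mono : ∀ {n N} {adj adj′ : Fin n → Fin n → Bool} {κ : Coloring n N} →
                (∀ {a b} → T (adj a b) → T (adj′ a b)) → IsProper adj′ κ → IsProper adj κ
IsProper-mono adj⊆adj′ κ-proper = record { nonEmpty = nonEmpty ; disjoint = disjoint ∘ adj⊆adj′ }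
  where open IsProper κ-proper

module _ (G : WGraph) {N : ℕ} where

  record Contributes (m : Fin N → ℕ) (κ : Coloring (n G) N) : Set where
    constructor contributes
    field
      proper   : IsProper (adj G) κ
      monomial : HasMonomial (ω G) m κ

  module _ {m : Fin N → ℕ} {κ : Coloring (n G) N} where
    private
      disjointᵇ : Fin (n G) → Fin (n G) → Bool
      disjointᵇ a b = all (λ i → not (κ a i ∧ κ b i)) (allFin N)

      edgeOkᵇ : Fin (n G) → Fin (n G) → Bool
      edgeOkᵇ a b = not (adj G a b) ∨ disjointᵇ a b

      disjoint⇔ : ∀ a b → T (disjointᵇ a b) ⇔ Disjoint (κ a) (κ b)
      disjoint⇔ a b = T-all-allFin (λ i → T-nand)

      edges⇔ : T (all (λ a → all (edgeOkᵇ a) (allFin (n G))) (allFin (n G))) ⇔ (∀ a b → T (adj G a b) → Disjoint (κ a) (κ b))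
      edges⇔ = T-all-allFin λ a → T-all-allFin λ b →
        mk⇔ (λ t e → ⇔.to (disjoint⇔ a b) (⇔.to T-⇒ t e)) (λ h → ⇔.from T-⇒ (λ e → ⇔.from (disjoint⇔ a b) (h e)))

      isProper⇔ : T (isProperSetColoring G N κ) ⇔ IsProper (adj G) κ
      isProper⇔ = mk⇔
        (λ t → let ne , ed = ⇔.to T-∧ t in
               record { nonEmpty = ⇔.to (T-all-allFin (λ u → T-any-allFin (κ u))) ne ; disjoint = ⇔.to edges⇔ ed _ _ })
        (λ κ-proper → let open IsProper κ-proper in
               ⇔.from T-∧ (⇔.from (T-all-allFin (λ u → T-any-allFin (κ u))) nonEmpty , ⇔.from edges⇔ (λ a b → disjoint)))

      hasMonomial⇔ : T (hasMonomial G N κ m) ⇔ HasMonomial (ω G) m κ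
      hasMonomial⇔ = T-all-allFin λ i → mk⇔
        (λ t → trans (sym (sum-map-allFin (share i))) (≡ᵇ⇒≡ _ _ t))
        (λ h → ≡⇒≡ᵇ _ _ (trans (sum-map-allFin (share i)) h))
        where
        share : Fin N → Fin (n G) → ℕ
        share i u = if κ u i then ω G u else 0

    T⇔Contributes : T (isProperSetColoring G N κ ∧ hasMonomial G N κ m) ⇔ Contributes m κ
    T⇔Contributes = mk⇔
      (λ t → let p , h = ⇔.to T-∧ t in contributes (⇔.to isProper⇔ p) (⇔.to hasMonomial⇔ h))
      (λ (contributes p h) → ⇔.from T-∧ (⇔.from isProper⇔ p , ⇔.from hasMonomial⇔ h))

  contributes? : (m : Fin N → ℕ) → Decidable (Contributes m)
  contributes? m κ = Dec.map T⇔Contributes (T? (isProperSetColoring G N κ ∧ hasMonomial G N κ m))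

  Xcoeff≡count : ∀ m → Xcoeff G N m ≡ count (contributes? m) (allColorings (n G) N)
  Xcoeff≡count m = count-cong (λ κ → T? (isProperSetColoring G N κ ∧ hasMonomial G N κ m)) (contributes? m)
                              (allColorings (n G) N) (λ κ → T⇔Contributes)

  Contributes-resp : ∀ {m} → Contributes m Respects DecSetoid._≈_ (Colorings (n G) N)
  Contributes-resp {m} {κ} {κ′} κ≈κ′ (contributes κ-proper mono) =
    contributes proper′ (λ i → trans (sym (weight-cong (ω G) κ≈κ′ i)) (mono i))
    where
    open IsProper κ-proper
    proper′ : IsProper (adj G) κ′
    proper′ = record
      { nonEmpty = λ u → let i , κui = nonEmpty u in i , subst T (κ≈κ′ u i) κui
      ; disjoint = λ e → Disjoint-resp (κ≈κ′ _) (κ≈κ′ _) (disjoint e)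
      }

module SplitByOverlap (k : ℕ) (adj : Fin (suc k) → Fin (suc k) → Bool) (ω : Fin (suc k) → ℕ)
                (adj-sym : ∀ a b → adj a b ≡ adj b a) (adj-irr : ∀ a → adj a a ≡ false)
                {N : ℕ} (m : Fin N → ℕ) where

  G : WGraph
  G = wgraph (suc k) adj ω

  Cols : List (Coloring (suc k) N)
  Cols = allColorings (suc k) N

  open DecSetoid (Colorings (suc k) N) using (_≈_) renaming (sym to ≈-sym)

  Separated Nested : Fin (suc k) → Fin (suc k) → Pred (Coloring (suc k) N) 0ℓ
  Separated v w κ = Disjoint (κ v) (κ w)
  Nested    v w κ = κ v ⊆ κ w

  separated? : ∀ v w → Decidable (Separated v w)
  separated? v w κ = disjoint? (κ v) (κ w)

  nested? : ∀ v w → Decidable (Nested v w)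
  nested? v w κ = κ v ⊆? κ w

  Separated-resp : ∀ v w → Separated v w Respects _≈_
  Separated-resp v w κ≈κ′ = Disjoint-resp (κ≈κ′ v) (κ≈κ′ w)

  Nested-resp : ∀ v w → Nested v w Respects _≈_
  Nested-resp v w κ≈κ′ = ⊆-resp (κ≈κ′ v) (κ≈κ′ w)

  T-adj-sym : ∀ {a b} → T (adj a b) → T (adj b a)
  T-adj-sym {a} {b} = subst T (adj-sym a b)

  module _ (v w : Fin (suc k)) where
    open Ops (suc k) adj ω v w using (pairvw; unionE)

    pairvw-elim : ∀ {a b} → T (pairvw a b) → (a ≡ v × b ≡ w) ⊎ (a ≡ w × b ≡ v)
    pairvw-elim {a} {b} t with ⇔.to T-∨ t
    ... | inj₁ t′ = let a=v , b=w = ⇔.to T-∧ t′ in inj₁ (T-== a=v , T-== b=w)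
    ... | inj₂ t′ = let a=w , b=v = ⇔.to T-∧ t′ in inj₂ (T-== a=w , T-== b=v)

    pairvw-vw : T (pairvw v w)
    pairvw-vw = ⇔.from (T-∨ {(v == v) ∧ (w == w)}) (inj₁ (⇔.from (T-∧ {v == v} {w == w}) (fromWitness refl , fromWitness refl)))

    pairvw-wv : T (pairvw w v)
    pairvw-wv = ⇔.from (T-∨ {(w == v) ∧ (v == w)}) (inj₂ (⇔.from (T-∧ {w == w} {v == v}) (fromWitness refl , fromWitness refl)))

    separated⇔unionE : ∀ κ → (Contributes G m ∩ Separated v w) κ ⇔ Contributes unionE m κ
    separated⇔unionE κ = mk⇔
      (λ (contributes κ-proper mono , vw-disjoint) →
        contributes (record { nonEmpty = IsProper.nonEmpty κ-proper ; disjoint = disjoint′ κ-proper vw-disjoint }) mono)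
      (λ (contributes κ-proper′ mono) →
        contributes (IsProper-mono (⇔.from T-∨ ∘ inj₁) κ-proper′) mono ,
        IsProper.disjoint κ-proper′ (⇔.from (T-∨ {adj v w}) (inj₂ pairvw-vw)))
      where
      disjoint′ : IsProper adj κ → Separated v w κ → ∀ {a b} → T (adj a b ∨ pairvw a b) → Disjoint (κ a) (κ b)
      disjoint′ κ-proper vw-disjoint {a} {b} e with ⇔.to T-∨ e
      ... | inj₁ a~b = IsProper.disjoint κ-proper a~b
      ... | inj₂ ab=vw with pairvw-elim {a} {b} ab=vw
      ... | inj₁ (refl , refl) = vw-disjoint
      ... | inj₂ (refl , refl) = Disjoint-sym vw-disjoint

  ClosedNbr : Fin (suc k) → Fin (suc k) → Set
  ClosedNbr w b = b ≡ w ⊎ T (adj w b)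

  -- Instantiated with (v, w) for G¹ and with (w, v) for G²; joined tests for the edge vw in
  -- either orientation and ωvw is the merged weight.
  module StrictlyNested (v w : Fin (suc k)) (v≢w : v ≢ w)
    (joined : Fin (suc k) → Fin (suc k) → Bool)
    (joined-elim : ∀ {a b} → T (joined a b) → (a ≡ v × b ≡ w) ⊎ (a ≡ w × b ≡ v))
    (joined-vw : T (joined v w))
    (ωvw : ℕ) (ωvw≡ : ωvw ≡ ω v + ω w)
    where

    adjH : Fin (suc k) → Fin (suc k) → Bool
    adjH a b = adj a b ∨ joined a b ∨ ((a == v) ∧ adj w b) ∨ ((b == v) ∧ adj w a)

    ωH : Fin (suc k) → ℕ
    ωH u = if u == v then ωvw else ω u

    H : WGraph
    H = wgraph (suc k) adjH ωH

    adjH-elim : ∀ {a b} → T (adjH a b) → T (adj a b) ⊎ (a ≡ v × ClosedNbr w b) ⊎ (b ≡ v × ClosedNbr w a)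
    adjH-elim {a} {b} e with ⇔.to (T-∨ {adj a b}) e
    ... | inj₁ a~b = inj₁ a~b
    ... | inj₂ e′ with ⇔.to (T-∨ {joined a b}) e′
    ... | inj₁ ab with joined-elim ab
    ...   | inj₁ (a=v , b=w) = inj₂ (inj₁ (a=v , inj₁ b=w))
    ...   | inj₂ (a=w , b=v) = inj₂ (inj₂ (b=v , inj₁ a=w))
    adjH-elim {a} {b} e | inj₂ e′ | inj₂ e″ with ⇔.to (T-∨ {(a == v) ∧ adj w b}) e″
    ... | inj₁ vb = let a=v , w~b = ⇔.to T-∧ vb in inj₂ (inj₁ (T-== a=v , inj₂ w~b))
    ... | inj₂ va = let b=v , w~a = ⇔.to T-∧ va in inj₂ (inj₂ (T-== b=v , inj₂ w~a))

    adj⇒adjH : ∀ {a b} → T (adj a b) → T (adjH a b)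
    adj⇒adjH = ⇔.from T-∨ ∘ inj₁

    nbr⇒adjH : ∀ {b} → ClosedNbr w b → T (adjH v b)
    nbr⇒adjH {b} (inj₁ refl) = ⇔.from (T-∨ {adj v w}) (inj₂ (⇔.from T-∨ (inj₁ joined-vw)))
    nbr⇒adjH {b} (inj₂ w~b)  = ⇔.from (T-∨ {adj v b}) (inj₂ (⇔.from (T-∨ {joined v b}) (inj₂
                                 (⇔.from (T-∨ {(v == v) ∧ adj w b}) (inj₁ (⇔.from T-∧ (fromWitness refl , w~b)))))))

    ωH-v : ωH v ≡ ω v + ω w
    ωH-v = trans (cong (λ z → if z then ωvw else ω v) (==-refl v)) ωvw≡

    ωH-other : ∀ {u} → u ≢ v → ωH u ≡ ω u
    ωH-other u≢v = cong (λ z → if z then ωvw else _) (==-≢ u≢v)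

    Case : Pred (Coloring (suc k) N) 0ℓ
    Case = ((Contributes G m ∩ ∁ (Separated v w)) ∩ Nested v w) ∩ ∁ (Nested w v)

    case? : Decidable Case
    case? = ((contributes? G m ∩? ∁? (separated? v w)) ∩? nested? v w) ∩? ∁? (nested? w v)

    w≢v : w ≢ v
    w≢v = v≢w ∘ sym

    shrink grow : Coloring (suc k) N → Coloring (suc k) N
    shrink κ = updateAt κ w (λ S i → S i ∧ not (κ v i))
    grow   κ = updateAt κ w (λ S i → S i ∨ κ v i)

    shrink-w : ∀ κ i → shrink κ w i ≡ (κ w i ∧ not (κ v i))
    shrink-w κ i = cong (λ S → S i) (updateAt-updates w κ)

    grow-w : ∀ κ i → grow κ w i ≡ (κ w i ∨ κ v i)
    grow-w κ i = cong (λ S → S i) (updateAt-updates w κ)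

    shrink-other : ∀ κ {u} → u ≢ w → ∀ i → shrink κ u i ≡ κ u i
    shrink-other κ {u} u≢w i = cong (λ S → S i) (updateAt-minimal u w κ u≢w)

    grow-other : ∀ κ {u} → u ≢ w → ∀ i → grow κ u i ≡ κ u i
    grow-other κ {u} u≢w i = cong (λ S → S i) (updateAt-minimal u w κ u≢w)

    shrink-weight : ∀ κ i → (T (κ v i) → T (κ w i)) → weight ωH (shrink κ) i ≡ weight ω κ i
    shrink-weight κ i v⇒w = sum-local₂ {c = 0} v≢w agree (begin
      (if shrink κ v i then ωH v else 0) + (if shrink κ w i then ωH w else 0)
        ≡⟨ cong₂ (λ x y → (if x then ωH v else 0) + (if y then ωH w else 0)) (shrink-other κ v≢w i) (shrink-w κ i) ⟩
      (if κ v i then ωH v else 0) + (if κ w i ∧ not (κ v i) then ωH w else 0)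
        ≡⟨ cong₂ (λ a b → (if κ v i then a else 0) + (if κ w i ∧ not (κ v i) then b else 0)) ωH-v (ωH-other w≢v) ⟩
      (if κ v i then ω v + ω w else 0) + (if κ w i ∧ not (κ v i) then ω w else 0)
        ≡⟨ merged-weight (κ v i) (κ w i) (ω v) (ω w) v⇒w ⟩
      (if κ v i then ω v else 0) + (if κ w i then ω w else 0) ∎)
      where
      agree : ∀ u → u ≢ v → u ≢ w → (if κ u i then ω u else 0) ≡ (if shrink κ u i then ωH u else 0)
      agree u u≢v u≢w = sym (cong₂ (λ x a → if x then a else 0) (shrink-other κ u≢w i) (ωH-other u≢v))

    private
      T-shrink : ∀ κ u i → T (shrink κ u i) → T (κ u i)
      T-shrink κ u i with u ≟ w
      ... | yes refl = proj₁ ∘ ⇔.to T-∧ ∘ subst T (shrink-w κ i)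
      ... | no u≢w   = subst T (shrink-other κ u≢w i)

      T-grow : ∀ κ u i → T (grow κ u i) → T (κ u i) ⊎ (u ≡ w × T (κ v i))
      T-grow κ u i with u ≟ w
      ... | yes refl = Sum.map₂ (refl ,_) ∘ ⇔.to T-∨ ∘ subst T (grow-w κ i)
      ... | no u≢w   = inj₁ ∘ subst T (grow-other κ u≢w i)

      grow-⊇ : ∀ κ u i → T (κ u i) → T (grow κ u i)
      grow-⊇ κ u i with u ≟ w
      ... | yes refl = subst T (sym (grow-w κ i)) ∘ ⇔.from T-∨ ∘ inj₁
      ... | no u≢w   = subst T (sym (grow-other κ u≢w i))

      updateAt-w-cong : ∀ (upd : Coloring (suc k) N → Coloring (suc k) N) →
                        (∀ κ {u} → u ≢ w → ∀ i → upd κ u i ≡ κ u i) →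
                        ∀ {κ κ′} → κ ≈ κ′ → (∀ i → upd κ w i ≡ upd κ′ w i) → upd κ ≈ upd κ′
      updateAt-w-cong upd upd-other {κ} {κ′} κ≈κ′ w-agree u i with u ≟ w
      ... | yes refl = w-agree i
      ... | no u≢w   = trans (upd-other κ u≢w i) (trans (κ≈κ′ u i) (sym (upd-other κ′ u≢w i)))

    shrink-∈ : ∀ {κ} → Case κ → Contributes H m (shrink κ)
    shrink-∈ {κ} (((contributes κ-proper mono , ¬sep) , v⊆w) , w⊈v) =
      contributes (record { nonEmpty = nonEmpty′ ; disjoint = disjoint′ })
                  (λ i → trans (shrink-weight κ i (v⊆w i)) (mono i))
      where
      open IsProper κ-proper

      nonEmpty′ : ∀ u → NonEmpty (shrink κ u)
      nonEmpty′ u with u ≟ w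
      ... | yes refl = let i , κwi , ¬κvi = ¬⊆-witness w⊈v in
                       i , subst T (sym (shrink-w κ i)) (⇔.from T-∧ (κwi , ⇔.from T-not ¬κvi))
      ... | no u≢w   = let i , κui = nonEmpty u in i , subst T (sym (shrink-other κ u≢w i)) κui

      v-disjoint : ∀ {b} → ClosedNbr w b → Disjoint (shrink κ v) (shrink κ b)
      v-disjoint (inj₁ refl) i (x , y) =
        ⇔.to T-not (proj₂ (⇔.to T-∧ (subst T (shrink-w κ i) y))) (T-shrink κ v i x)
      v-disjoint (inj₂ w~b)  i (x , y) = disjoint w~b i (v⊆w i (T-shrink κ v i x) , T-shrink κ _ i y)

      disjoint′ : ∀ {a b} → T (adjH a b) → Disjoint (shrink κ a) (shrink κ b)
      disjoint′ {a} {b} e with adjH-elim e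
      ... | inj₁ a~b                = λ i (x , y) → disjoint a~b i (T-shrink κ a i x , T-shrink κ b i y)
      ... | inj₂ (inj₁ (refl , nbr)) = v-disjoint nbr
      ... | inj₂ (inj₂ (refl , nbr)) = Disjoint-sym (v-disjoint nbr)

    private
      vw-disjoint : ∀ {κ : Coloring (suc k) N} → IsProper adjH κ → Disjoint (κ v) (κ w)
      vw-disjoint κ-proper = IsProper.disjoint κ-proper (nbr⇒adjH (inj₁ refl))

    shrink∘grow : ∀ {κ} → Contributes H m κ → shrink (grow κ) ≈ κ
    shrink∘grow {κ} (contributes κ-proper _) u i with u ≟ w
    ... | no u≢w   = trans (shrink-other (grow κ) u≢w i) (grow-other κ u≢w i)
    ... | yes refl = begin
      shrink (grow κ) w i
        ≡⟨ shrink-w (grow κ) i ⟩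
      grow κ w i ∧ not (grow κ v i)
        ≡⟨ cong₂ (λ x y → x ∧ not y) (grow-w κ i) (grow-other κ v≢w i) ⟩
      (κ w i ∨ κ v i) ∧ not (κ v i)
        ≡⟨ remove-∨ (κ w i) (κ v i) (Disjoint-sym (vw-disjoint κ-proper) i) ⟩
      κ w i ∎

    grow∘shrink : ∀ {κ} → Case κ → grow (shrink κ) ≈ κ
    grow∘shrink {κ} ((_ , v⊆w) , _) u i with u ≟ w
    ... | no u≢w   = trans (grow-other (shrink κ) u≢w i) (shrink-other κ u≢w i)
    ... | yes refl = begin
      grow (shrink κ) w i                          ≡⟨ grow-w (shrink κ) i ⟩
      shrink κ w i ∨ shrink κ v i                  ≡⟨ cong₂ _∨_ (shrink-w κ i) (shrink-other κ v≢w i) ⟩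
      (κ w i ∧ not (κ v i)) ∨ κ v i                ≡⟨ restore-∧-not (κ w i) (κ v i) (v⊆w i) ⟩
      κ w i ∎

    grow-∈ : ∀ {κ} → Contributes H m κ → Case (grow κ)
    grow-∈ {κ} c@(contributes κ-proper mono) = ((contributes proper mono′ , ¬separated) , nested) , ¬nested
      where
      open IsProper κ-proper

      proper : IsProper adj (grow κ)
      proper = record
        { nonEmpty = λ u → let i , κui = nonEmpty u in i , grow-⊇ κ u i κui
        ; disjoint = λ {a} {b} a~b i (x , y) → edge a~b i (T-grow κ a i x) (T-grow κ b i y)
        }
        where
        edge : ∀ {a b} → T (adj a b) → ∀ i → T (κ a i) ⊎ (a ≡ w × T (κ v i)) → T (κ b i) ⊎ (b ≡ w × T (κ v i)) → ⊥
        edge a~b i (inj₁ x)          (inj₁ y)          = disjoint (adj⇒adjH a~b) i (x , y)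
        edge a~b i (inj₂ (refl , x)) (inj₁ y)          = disjoint (nbr⇒adjH (inj₂ a~b)) i (x , y)
        edge a~b i (inj₁ x)          (inj₂ (refl , y)) = disjoint (nbr⇒adjH (inj₂ (T-adj-sym a~b))) i (y , x)
        edge a~b i (inj₂ (refl , _)) (inj₂ (refl , _)) = subst T (adj-irr w) a~b

      nested : Nested v w (grow κ)
      nested i x = subst T (sym (grow-w κ i)) (⇔.from T-∨ (inj₂ (subst T (grow-other κ v≢w i) x)))

      ¬separated : ¬ Separated v w (grow κ)
      ¬separated sep = let i , κvi = nonEmpty v in sep i (grow-⊇ κ v i κvi , nested i (grow-⊇ κ v i κvi))

      ¬nested : ¬ Nested w v (grow κ)
      ¬nested w⊆v = let i , κwi = nonEmpty w in
        vw-disjoint κ-proper i (subst T (grow-other κ v≢w i) (w⊆v i (grow-⊇ κ w i κwi)) , κwi)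

      mono′ : HasMonomial ω m (grow κ)
      mono′ i = begin
        weight ω (grow κ) i                  ≡⟨ shrink-weight (grow κ) i (nested i) ⟨
        weight ωH (shrink (grow κ)) i        ≡⟨ weight-cong ωH (shrink∘grow c) i ⟩
        weight ωH κ i                        ≡⟨ mono i ⟩
        m i ∎

    inverse : InverseOn (Colorings (suc k) N) (Colorings (suc k) N) Case (Contributes H m)
    inverse = record
      { to        = shrink
      ; from      = grow
      ; to-cong   = λ {κ} {κ′} κ≈κ′ → updateAt-w-cong shrink shrink-other κ≈κ′
                      (λ i → trans (shrink-w κ i)
                               (trans (cong₂ (λ x y → x ∧ not y) (κ≈κ′ w i) (κ≈κ′ v i)) (sym (shrink-w κ′ i))))
      ; from-cong = λ {κ} {κ′} κ≈κ′ → updateAt-w-cong grow grow-other κ≈κ′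
                      (λ i → trans (grow-w κ i) (trans (cong₂ _∨_ (κ≈κ′ w i) (κ≈κ′ v i)) (sym (grow-w κ′ i))))
      ; to-∈      = shrink-∈
      ; from-∈    = grow-∈
      ; from∘to   = grow∘shrink
      ; to∘from   = shrink∘grow
      }

    count-case : count case? Cols ≡ count (contributes? H m) (allColorings (n H) N)
    count-case = count-InverseOn (Colorings (suc k) N) (Colorings (suc k) N) case? (contributes? H m)
      Case-resp (Contributes-resp H) inverse {Cols} {Cols}
      (allColorings-enumerates (suc k) N) (allColorings-enumerates (suc k) N)
      where
      Case-resp : Case Respects _≈_
      Case-resp κ≈κ′ (((c , ¬sep) , nest) , ¬nest) =
        ((Contributes-resp G κ≈κ′ c , ¬sep ∘ Separated-resp v w (≈-sym κ≈κ′)) , Nested-resp v w κ≈κ′ nest) ,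
        ¬nest ∘ Nested-resp w v (≈-sym κ≈κ′)

  module Contraction (v w : Fin (suc k)) (v≢w : v ≢ w) where

    H : WGraph
    H = contract k adj ω v w

    Case : Pred (Coloring (suc k) N) 0ℓ
    Case = ((Contributes G m ∩ ∁ (Separated v w)) ∩ Nested v w) ∩ Nested w v

    case? : Decidable Case
    case? = ((contributes? G m ∩? ∁? (separated? v w)) ∩? nested? v w) ∩? nested? w v

    w≢v : w ≢ v
    w≢v = v≢w ∘ sym

    v′ : Fin k
    v′ = punchOut w≢v

    punchIn-v′ : punchIn w v′ ≡ v
    punchIn-v′ = punchIn-punchOut w≢v

    merge : Coloring (suc k) N → Coloring k N
    merge κ = removeAt κ w

    split : Coloring k N → Coloring (suc k) N
    split κ = insertAt κ w (κ v′)

    split-v : ∀ κ → split κ v ≡ κ v′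
    split-v κ = trans (cong (split κ) (sym punchIn-v′)) (insertAt-punchIn κ w (κ v′) v′)

    split-w : ∀ κ → split κ w ≡ κ v′
    split-w κ = insertAt-lookup κ w (κ v′)

    merge-weight : ∀ κ i → κ v i ≡ κ w i → weight (WGraph.ω H) (merge κ) i ≡ weight ω κ i
    merge-weight κ i κvi≡κwi = begin
      weight (WGraph.ω H) (merge κ) i
        ≡⟨ sum-local₁ {F = removeAt F w} {merged ∘ punchIn w} {F w} v′ agree at-v′ ⟩
      F w + ℕSum.sum (removeAt F w)
        ≡⟨ ℕSum.sum-remove F ⟨
      weight ω κ i ∎
      where
      F : Fin (suc k) → ℕ
      F u = if κ u i then ω u else 0
      merged : Fin (suc k) → ℕ
      merged u = if κ u i then (if u == v then ω v + ω w else ω u) else 0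
      agree : ∀ a → a ≢ v′ → removeAt F w a ≡ merged (punchIn w a)
      agree a a≢v′ = cong (λ b → if κ (punchIn w a) i then b else 0)
        (sym (cong (λ z → if z then ω v + ω w else ω (punchIn w a))
          (==-≢ (λ eq → a≢v′ (punchIn-injective w a v′ (trans eq (sym punchIn-v′)))))))
      at-v′ : merged (punchIn w v′) ≡ F w + removeAt F w v′
      at-v′ = begin
        merged (punchIn w v′)
          ≡⟨ cong merged punchIn-v′ ⟩
        (if κ v i then (if v == v then ω v + ω w else ω v) else 0)
          ≡⟨ cong (λ z → if κ v i then (if z then ω v + ω w else ω v) else 0) (==-refl v) ⟩
        (if κ v i then ω v + ω w else 0)
          ≡⟨ split-weight (κ v i) (ω v) (ω w) ⟩
        (if κ v i then ω w else 0) + F v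
          ≡⟨ cong₂ (λ z u → (if z then ω w else 0) + F u) κvi≡κwi (sym punchIn-v′) ⟩
        F w + F (punchIn w v′) ∎

    ContractedEdge : Fin k → Fin k → Set
    ContractedEdge a b = T (adj (punchIn w a) (punchIn w b))
                       ⊎ (punchIn w a ≡ v × T (adj w (punchIn w b)))
                       ⊎ (punchIn w b ≡ v × T (adj (punchIn w a) w))

    H-adj⇔ : ∀ {a b} → T (WGraph.adj H a b) ⇔ ContractedEdge a b
    H-adj⇔ {a} {b} = mk⇔ decode encode
      where
      a′ b′ : Fin (suc k)
      a′ = punchIn w a
      b′ = punchIn w b
      decode : T (WGraph.adj H a b) → ContractedEdge a b
      decode e with ⇔.to (T-∨ {adj a′ b′}) e
      ... | inj₁ a~b = inj₁ a~b
      ... | inj₂ e′ with ⇔.to (T-∨ {(a′ == v) ∧ adj w b′}) e′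
      ... | inj₁ zw = let isZ , w~b = ⇔.to T-∧ zw in inj₂ (inj₁ (T-== isZ , w~b))
      ... | inj₂ zw = let isZ , a~w = ⇔.to T-∧ zw in inj₂ (inj₂ (T-== isZ , a~w))
      encode : ContractedEdge a b → T (WGraph.adj H a b)
      encode (inj₁ a~b)               = ⇔.from (T-∨ {adj a′ b′}) (inj₁ a~b)
      encode (inj₂ (inj₁ (a=v , w~b))) = ⇔.from (T-∨ {adj a′ b′}) (inj₂ (⇔.from (T-∨ {(a′ == v) ∧ adj w b′})
                                           (inj₁ (⇔.from T-∧ (fromWitness a=v , w~b)))))
      encode (inj₂ (inj₂ (b=v , a~w))) = ⇔.from (T-∨ {adj a′ b′}) (inj₂ (⇔.from (T-∨ {(a′ == v) ∧ adj w b′})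
                                           (inj₂ (⇔.from T-∧ (fromWitness b=v , a~w)))))

    merge-∈ : ∀ {κ} → Case κ → Contributes H m (merge κ)
    merge-∈ {κ} (((contributes κ-proper mono , _) , v⊆w) , w⊆v) =
      contributes (record { nonEmpty = nonEmpty ∘ punchIn w ; disjoint = disjoint′ })
                  (λ i → trans (merge-weight κ i (T-injective (mk⇔ (v⊆w i) (w⊆v i)))) (mono i))
      where
      open IsProper κ-proper

      as-w : ∀ {u} → u ≡ v → κ u ⊆ κ w
      as-w refl = v⊆w

      disjoint′ : ∀ {a b} → T (WGraph.adj H a b) → Disjoint (merge κ a) (merge κ b)
      disjoint′ e i (x , y) with ⇔.to H-adj⇔ e
      ... | inj₁ a~b                = disjoint a~b i (x , y)
      ... | inj₂ (inj₁ (a=v , w~b)) = disjoint w~b i (as-w a=v i x , y)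
      ... | inj₂ (inj₂ (b=v , a~w)) = disjoint a~w i (x , as-w b=v i y)

    split-∈ : ∀ {κ} → Contributes H m κ → Case (split κ)
    split-∈ {κ} (contributes κ-proper mono) = ((contributes proper mono′ , ¬separated) , nested-vw) , nested-wv
      where
      open IsProper κ-proper

      split-punchIn : ∀ a → split κ (punchIn w a) ≡ κ a
      split-punchIn a = insertAt-punchIn κ w (κ v′) a

      proper : IsProper adj (split κ)
      proper = record { nonEmpty = nonEmpty′ ; disjoint = λ {a} {b} → disjoint′ (punchView w a) (punchView w b) }
        where
        nonEmpty′ : ∀ u → NonEmpty (split κ u)
        nonEmpty′ u with punchView w u
        ... | pivot     = subst NonEmpty (sym (split-w κ)) (nonEmpty v′)
        ... | punched a = subst NonEmpty (sym (split-punchIn a)) (nonEmpty a)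

        disjoint′ : ∀ {a b} → PunchView w a → PunchView w b → T (adj a b) → Disjoint (split κ a) (split κ b)
        disjoint′ pivot       pivot       w~w _ _ = subst T (adj-irr w) w~w
        disjoint′ pivot       (punched b) w~b   = subst₂ Disjoint (sym (split-w κ)) (sym (split-punchIn b))
          (disjoint (⇔.from H-adj⇔ (inj₂ (inj₁ (punchIn-v′ , w~b)))))
        disjoint′ (punched a) pivot       a~w   = subst₂ Disjoint (sym (split-punchIn a)) (sym (split-w κ))
          (disjoint (⇔.from H-adj⇔ (inj₂ (inj₂ (punchIn-v′ , a~w)))))
        disjoint′ (punched a) (punched b) a~b   = subst₂ Disjoint (sym (split-punchIn a)) (sym (split-punchIn b))
          (disjoint (⇔.from H-adj⇔ (inj₁ a~b)))

      v≗w : ∀ i → split κ v i ≡ split κ w i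
      v≗w i = cong (λ S → S i) (trans (split-v κ) (sym (split-w κ)))

      ¬separated : ¬ Separated v w (split κ)
      ¬separated sep = let i , κv′i = nonEmpty v′ in
        sep i ( subst T (sym (cong (λ S → S i) (split-v κ))) κv′i
              , subst T (sym (cong (λ S → S i) (split-w κ))) κv′i )

      nested-vw : Nested v w (split κ)
      nested-vw i = subst T (v≗w i)

      nested-wv : Nested w v (split κ)
      nested-wv i = subst T (sym (v≗w i))

      mono′ : HasMonomial ω m (split κ)
      mono′ i = begin
        weight ω (split κ) i
          ≡⟨ merge-weight (split κ) i (v≗w i) ⟨
        weight (WGraph.ω H) (merge (split κ)) i
          ≡⟨ weight-cong (WGraph.ω H) (λ a i → cong (λ S → S i) (removeAt-insertAt κ w (κ v′) a)) i ⟩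
        weight (WGraph.ω H) κ i
          ≡⟨ mono i ⟩
        m i ∎

    split∘merge : ∀ {κ} → Case κ → split (merge κ) ≈ κ
    split∘merge {κ} ((_ , v⊆w) , w⊆v) u i with punchView w u
    ... | pivot     = begin
      split (merge κ) w i     ≡⟨ cong (λ S → S i) (split-w (merge κ)) ⟩
      κ (punchIn w v′) i      ≡⟨ cong (λ u → κ u i) punchIn-v′ ⟩
      κ v i                   ≡⟨ T-injective (mk⇔ (v⊆w i) (w⊆v i)) ⟩
      κ w i                   ∎
    ... | punched a = cong (λ S → S i) (insertAt-punchIn (merge κ) w _ a)

    split-cong : ∀ {κ κ′ : Coloring k N} → (∀ a i → κ a i ≡ κ′ a i) → split κ ≈ split κ′
    split-cong {κ} {κ′} κ≈κ′ u i with punchView w u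
    ... | pivot     = trans (cong (λ S → S i) (split-w κ)) (trans (κ≈κ′ v′ i) (cong (λ S → S i) (sym (split-w κ′))))
    ... | punched a = trans (cong (λ S → S i) (insertAt-punchIn κ w _ a))
                            (trans (κ≈κ′ a i) (cong (λ S → S i) (sym (insertAt-punchIn κ′ w _ a))))

    inverse : InverseOn (Colorings (suc k) N) (Colorings k N) Case (Contributes H m)
    inverse = record
      { to        = merge
      ; from      = split
      ; to-cong   = λ κ≈κ′ a → κ≈κ′ (punchIn w a)
      ; from-cong = split-cong
      ; to-∈      = merge-∈
      ; from-∈    = split-∈
      ; from∘to   = split∘merge
      ; to∘from   = λ {κ} _ a i → cong (λ S → S i) (removeAt-insertAt κ w (κ v′) a)
      }

    count-case : count case? Cols ≡ count (contributes? H m) (allColorings (n H) N)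
    count-case = count-InverseOn (Colorings (suc k) N) (Colorings k N) case? (contributes? H m)
      Case-resp (Contributes-resp H) inverse {Cols} {allColorings k N}
      (allColorings-enumerates (suc k) N) (allColorings-enumerates k N)
      where
      Case-resp : Case Respects _≈_
      Case-resp κ≈κ′ (((c , ¬sep) , vw) , wv) =
        ((Contributes-resp G κ≈κ′ c , ¬sep ∘ Separated-resp v w (≈-sym κ≈κ′)) , Nested-resp v w κ≈κ′ vw) ,
        Nested-resp w v κ≈κ′ wv

  module Crossing (v w : Fin (suc k)) (v≢w : v ≢ w) (v≁w : adj v w ≡ false) where
    open Ops (suc k) adj ω v w using (zAdj; starAdj; Gstar)

    H : WGraph
    H = Gstar

    Case : Pred (Coloring (suc k) N) 0ℓ
    Case = ((Contributes G m ∩ ∁ (Separated v w)) ∩ ∁ (Nested v w)) ∩ ∁ (Nested w v)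

    case? : Decidable Case
    case? = ((contributes? G m ∩? ∁? (separated? v w)) ∩? ∁? (nested? v w)) ∩? ∁? (nested? w v)

    separate : Coloring (suc k) N → Coloring (suc (suc k)) N
    separate κ = (λ i → κ v i ∧ κ w i)
               Vector.∷ updateAt (updateAt κ v (λ S i → S i ∧ not (κ w i))) w (λ S i → S i ∧ not (κ v i))

    unite : Coloring (suc (suc k)) N → Coloring (suc k) N
    unite κ = updateAt (updateAt (tail κ) v (λ S i → S i ∨ κ zero i)) w (λ S i → S i ∨ κ zero i)

    _≈′_ : Coloring (suc (suc k)) N → Coloring (suc (suc k)) N → Set
    _≈′_ = DecSetoid._≈_ (Colorings (suc (suc k)) N)

    separate-v : ∀ κ i → separate κ (suc v) i ≡ (κ v i ∧ not (κ w i))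
    separate-v κ i = cong (λ S → S i) (updateAt₂-v v≢w κ _ _)

    separate-w : ∀ κ i → separate κ (suc w) i ≡ (κ w i ∧ not (κ v i))
    separate-w κ i = cong (λ S → S i) (updateAt₂-w v≢w κ _ _)

    separate-other : ∀ κ {u} → u ≢ v → u ≢ w → ∀ i → separate κ (suc u) i ≡ κ u i
    separate-other κ u≢v u≢w i = cong (λ S → S i) (updateAt₂-other v≢w κ _ _ u≢v u≢w)

    unite-v : ∀ κ i → unite κ v i ≡ (κ (suc v) i ∨ κ zero i)
    unite-v κ i = cong (λ S → S i) (updateAt₂-v v≢w (tail κ) _ _)

    unite-w : ∀ κ i → unite κ w i ≡ (κ (suc w) i ∨ κ zero i)
    unite-w κ i = cong (λ S → S i) (updateAt₂-w v≢w (tail κ) _ _)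

    unite-other : ∀ κ {u} → u ≢ v → u ≢ w → ∀ i → unite κ u i ≡ κ (suc u) i
    unite-other κ u≢v u≢w i = cong (λ S → S i) (updateAt₂-other v≢w (tail κ) _ _ u≢v u≢w)

    separate-weight : ∀ κ i → weight (WGraph.ω H) (separate κ) i ≡ weight ω κ i
    separate-weight κ i = sum-local₂ {c = if κ v i ∧ κ w i then ω v + ω w else 0} v≢w agree (begin
      (if κ v i ∧ κ w i then ω v + ω w else 0)
        + ((if separate κ (suc v) i then ω v else 0) + (if separate κ (suc w) i then ω w else 0))
          ≡⟨ cong₂ (λ x y → (if κ v i ∧ κ w i then ω v + ω w else 0) + ((if x then ω v else 0) + (if y then ω w else 0)))
                   (separate-v κ i) (separate-w κ i) ⟩
      (if κ v i ∧ κ w i then ω v + ω w else 0)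
        + ((if κ v i ∧ not (κ w i) then ω v else 0) + (if κ w i ∧ not (κ v i) then ω w else 0))
          ≡⟨ shared-weight (κ v i) (κ w i) (ω v) (ω w) ⟩
      (if κ v i then ω v else 0) + (if κ w i then ω w else 0) ∎)
      where
      agree : ∀ u → u ≢ v → u ≢ w → (if κ u i then ω u else 0) ≡ (if separate κ (suc u) i then ω u else 0)
      agree u u≢v u≢w = cong (λ x → if x then ω u else 0) (sym (separate-other κ u≢v u≢w i))

    zAdj⇔ : ∀ {b} → T (zAdj b) ⇔ (b ≡ v ⊎ b ≡ w ⊎ T (adj v b) ⊎ T (adj w b))
    zAdj⇔ {b} = mk⇔ decode encode
      where
      decode : T (zAdj b) → b ≡ v ⊎ b ≡ w ⊎ T (adj v b) ⊎ T (adj w b)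
      decode = Sum.map T-== (Sum.map T-== (⇔.to T-∨) ∘ ⇔.to T-∨) ∘ ⇔.to T-∨
      encode : b ≡ v ⊎ b ≡ w ⊎ T (adj v b) ⊎ T (adj w b) → T (zAdj b)
      encode = ⇔.from (T-∨ {b == v}) ∘ Sum.map fromWitness (⇔.from (T-∨ {b == w}) ∘ Sum.map fromWitness (⇔.from T-∨))

    private
      T-separate : ∀ κ u i → T (separate κ (suc u) i) → T (κ u i)
      T-separate κ u i with position v w u
      ... | at-v              = proj₁ ∘ ⇔.to T-∧ ∘ subst T (separate-v κ i)
      ... | at-w              = proj₁ ∘ ⇔.to T-∧ ∘ subst T (separate-w κ i)
      ... | elsewhere u≢v u≢w = subst T (separate-other κ u≢v u≢w i)

      T-unite : ∀ κ u i → T (unite κ u i) → T (κ (suc u) i) ⊎ ((u ≡ v ⊎ u ≡ w) × T (κ zero i))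
      T-unite κ u i with position v w u
      ... | at-v              = Sum.map₂ (inj₁ refl ,_) ∘ ⇔.to T-∨ ∘ subst T (unite-v κ i)
      ... | at-w              = Sum.map₂ (inj₂ refl ,_) ∘ ⇔.to T-∨ ∘ subst T (unite-w κ i)
      ... | elsewhere u≢v u≢w = inj₁ ∘ subst T (unite-other κ u≢v u≢w i)

      unite-⊇ : ∀ κ u i → T (κ (suc u) i) → T (unite κ u i)
      unite-⊇ κ u i with position v w u
      ... | at-v              = subst T (sym (unite-v κ i)) ∘ ⇔.from T-∨ ∘ inj₁
      ... | at-w              = subst T (sym (unite-w κ i)) ∘ ⇔.from T-∨ ∘ inj₁
      ... | elsewhere u≢v u≢w = subst T (sym (unite-other κ u≢v u≢w i))

      unite-v⊇ : ∀ κ i → T (κ zero i) → T (unite κ v i)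
      unite-v⊇ κ i = subst T (sym (unite-v κ i)) ∘ ⇔.from (T-∨ {κ (suc v) i}) ∘ inj₂

      unite-w⊇ : ∀ κ i → T (κ zero i) → T (unite κ w i)
      unite-w⊇ κ i = subst T (sym (unite-w κ i)) ∘ ⇔.from (T-∨ {κ (suc w) i}) ∘ inj₂

    separate-∈ : ∀ {κ} → Case κ → Contributes H m (separate κ)
    separate-∈ {κ} (((contributes κ-proper mono , ¬sep) , v⊈w) , w⊈v) =
      contributes (record { nonEmpty = nonEmpty′ ; disjoint = λ {x} {y} → disjoint′ x y })
                  (λ i → trans (separate-weight κ i) (mono i))
      where
      open IsProper κ-proper

      nonEmpty′ : ∀ x → NonEmpty (separate κ x)
      nonEmpty′ zero    = let i , κvi , κwi = ¬Disjoint-witness ¬sep in i , ⇔.from T-∧ (κvi , κwi)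
      nonEmpty′ (suc u) with position v w u
      ... | at-v = let i , κvi , ¬κwi = ¬⊆-witness v⊈w in
                   i , subst T (sym (separate-v κ i)) (⇔.from T-∧ (κvi , ⇔.from T-not ¬κwi))
      ... | at-w = let i , κwi , ¬κvi = ¬⊆-witness w⊈v in
                   i , subst T (sym (separate-w κ i)) (⇔.from T-∧ (κwi , ⇔.from T-not ¬κvi))
      ... | elsewhere u≢v u≢w = let i , κui = nonEmpty u in i , subst T (sym (separate-other κ u≢v u≢w i)) κui

      v-part : ∀ i → T (separate κ (suc v) i) → T (κ v i) × ¬ T (κ w i)
      v-part i x = Product.map₂ (⇔.to T-not) (⇔.to T-∧ (subst T (separate-v κ i) x))

      w-part : ∀ i → T (separate κ (suc w) i) → T (κ w i) × ¬ T (κ v i)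
      w-part i x = Product.map₂ (⇔.to T-not) (⇔.to T-∧ (subst T (separate-w κ i) x))

      vw-parts : Disjoint (separate κ (suc v)) (separate κ (suc w))
      vw-parts i (x , y) = proj₂ (v-part i x) (proj₁ (w-part i y))

      z-disjoint : ∀ {b} → T (zAdj b) → Disjoint (separate κ zero) (separate κ (suc b))
      z-disjoint {b} e i (z , y) with ⇔.to T-∧ z | ⇔.to (zAdj⇔ {b}) e
      ... | _ , κwi | inj₁ refl                  = proj₂ (v-part i y) κwi
      ... | κvi , _ | inj₂ (inj₁ refl)           = proj₂ (w-part i y) κvi
      ... | κvi , _ | inj₂ (inj₂ (inj₁ v~b))     = disjoint v~b i (κvi , T-separate κ b i y)
      ... | _ , κwi | inj₂ (inj₂ (inj₂ w~b))     = disjoint w~b i (κwi , T-separate κ b i y)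

      disjoint′ : ∀ x y → T (starAdj x y) → Disjoint (separate κ x) (separate κ y)
      disjoint′ zero    (suc b) e = z-disjoint e
      disjoint′ (suc a) zero    e = Disjoint-sym (z-disjoint e)
      disjoint′ (suc a) (suc b) e with ⇔.to (T-∨ {adj a b}) e
      ... | inj₁ a~b = λ i (x , y) → disjoint a~b i (T-separate κ a i x , T-separate κ b i y)
      ... | inj₂ ab=vw with pairvw-elim v w {a} {b} ab=vw
      ... | inj₁ (refl , refl) = vw-parts
      ... | inj₂ (refl , refl) = Disjoint-sym vw-parts

    private
      vw-edge : T (starAdj (suc v) (suc w))
      vw-edge = ⇔.from (T-∨ {adj v w}) (inj₂ (pairvw-vw v w))

      z-edge : ∀ {u} → u ≡ v ⊎ u ≡ w → T (starAdj zero (suc u))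
      z-edge (inj₁ refl) = ⇔.from zAdj⇔ (inj₁ refl)
      z-edge (inj₂ refl) = ⇔.from zAdj⇔ (inj₂ (inj₁ refl))

    separate∘unite : ∀ {κ} → Contributes H m κ → separate (unite κ) ≈′ κ
    separate∘unite {κ} c zero    i = trans (cong₂ _∧_ (unite-v κ i) (unite-w κ i))
                                           (common-part (κ (suc v) i) (κ (suc w) i) (κ zero i) (disjoint vw-edge i))
      where open IsProper (Contributes.proper c)
    separate∘unite {κ} c (suc u) i with position v w u
    ... | at-v = begin
      separate (unite κ) (suc v) i
        ≡⟨ separate-v (unite κ) i ⟩
      unite κ v i ∧ not (unite κ w i)
        ≡⟨ cong₂ (λ x y → x ∧ not y) (unite-v κ i) (unite-w κ i) ⟩
      (κ (suc v) i ∨ κ zero i) ∧ not (κ (suc w) i ∨ κ zero i)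
        ≡⟨ own-part _ _ _ (disjoint vw-edge i) (Disjoint-sym (disjoint (z-edge (inj₁ refl))) i) ⟩
      κ (suc v) i ∎
      where
      open IsProper (Contributes.proper c)
    ... | at-w = begin
      separate (unite κ) (suc w) i
        ≡⟨ separate-w (unite κ) i ⟩
      unite κ w i ∧ not (unite κ v i)
        ≡⟨ cong₂ (λ x y → x ∧ not y) (unite-w κ i) (unite-v κ i) ⟩
      (κ (suc w) i ∨ κ zero i) ∧ not (κ (suc v) i ∨ κ zero i)
        ≡⟨ own-part _ _ _ (Disjoint-sym (disjoint vw-edge) i) (Disjoint-sym (disjoint (z-edge (inj₂ refl))) i) ⟩
      κ (suc w) i ∎
      where
      open IsProper (Contributes.proper c)
    ... | elsewhere u≢v u≢w = trans (separate-other (unite κ) u≢v u≢w i) (unite-other κ u≢v u≢w i)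

    unite∘separate : ∀ κ → unite (separate κ) ≈ κ
    unite∘separate κ u i with position v w u
    ... | at-v = trans (unite-v (separate κ) i) (trans (cong (_∨ (κ v i ∧ κ w i)) (separate-v κ i)) (rejoinˡ (κ v i) (κ w i)))
    ... | at-w = trans (unite-w (separate κ) i) (trans (cong (_∨ (κ v i ∧ κ w i)) (separate-w κ i)) (rejoinʳ (κ v i) (κ w i)))
    ... | elsewhere u≢v u≢w = trans (unite-other (separate κ) u≢v u≢w i) (separate-other κ u≢v u≢w i)

    unite-∈ : ∀ {κ} → Contributes H m κ → Case (unite κ)
    unite-∈ {κ} c@(contributes κ-proper mono) = ((contributes proper mono′ , ¬separated) , ¬nested-vw) , ¬nested-wv
      where
      open IsProper κ-proper

      z-nbr : ∀ {a b} → a ≡ v ⊎ a ≡ w → T (adj a b) → T (starAdj zero (suc b))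
      z-nbr (inj₁ refl) v~b = ⇔.from zAdj⇔ (inj₂ (inj₂ (inj₁ v~b)))
      z-nbr (inj₂ refl) w~b = ⇔.from zAdj⇔ (inj₂ (inj₂ (inj₂ w~b)))

      vw-nonadjacent : ∀ {a b} → a ≡ v ⊎ a ≡ w → b ≡ v ⊎ b ≡ w → ¬ T (adj a b)
      vw-nonadjacent (inj₁ refl) (inj₁ refl) = subst T (adj-irr v)
      vw-nonadjacent (inj₁ refl) (inj₂ refl) = subst T v≁w
      vw-nonadjacent (inj₂ refl) (inj₁ refl) = subst T (trans (adj-sym w v) v≁w)
      vw-nonadjacent (inj₂ refl) (inj₂ refl) = subst T (adj-irr w)

      proper : IsProper adj (unite κ)
      proper = record
        { nonEmpty = λ u → let i , κui = nonEmpty (suc u) in i , unite-⊇ κ u i κui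
        ; disjoint = λ {a} {b} a~b i (x , y) → edge a~b i (T-unite κ a i x) (T-unite κ b i y)
        }
        where
        edge : ∀ {a b} → T (adj a b) → ∀ i →
               T (κ (suc a) i) ⊎ ((a ≡ v ⊎ a ≡ w) × T (κ zero i)) →
               T (κ (suc b) i) ⊎ ((b ≡ v ⊎ b ≡ w) × T (κ zero i)) → ⊥
        edge a~b i (inj₁ x)        (inj₁ y)        = disjoint (⇔.from (T-∨ {adj _ _}) (inj₁ a~b)) i (x , y)
        edge a~b i (inj₂ (a∈ , z)) (inj₁ y)        = disjoint (z-nbr a∈ a~b) i (z , y)
        edge a~b i (inj₁ x)        (inj₂ (b∈ , z)) = disjoint (z-nbr b∈ (T-adj-sym a~b)) i (z , x)
        edge a~b i (inj₂ (a∈ , _)) (inj₂ (b∈ , _)) = vw-nonadjacent a∈ b∈ a~b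

      ¬separated : ¬ Separated v w (unite κ)
      ¬separated sep = let i , z = nonEmpty zero in sep i (unite-v⊇ κ i z , unite-w⊇ κ i z)

      ¬nested-vw : ¬ Nested v w (unite κ)
      ¬nested-vw v⊆w with nonEmpty (suc v)
      ... | i , x with T-unite κ w i (v⊆w i (unite-⊇ κ v i x))
      ... | inj₁ y       = disjoint vw-edge i (x , y)
      ... | inj₂ (_ , z) = disjoint (z-edge (inj₁ refl)) i (z , x)

      ¬nested-wv : ¬ Nested w v (unite κ)
      ¬nested-wv w⊆v with nonEmpty (suc w)
      ... | i , y with T-unite κ v i (w⊆v i (unite-⊇ κ w i y))
      ... | inj₁ x       = disjoint vw-edge i (x , y)
      ... | inj₂ (_ , z) = disjoint (z-edge (inj₂ refl)) i (z , y)

      mono′ : HasMonomial ω m (unite κ)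
      mono′ i = begin
        weight ω (unite κ) i                          ≡⟨ separate-weight (unite κ) i ⟨
        weight (WGraph.ω H) (separate (unite κ)) i    ≡⟨ weight-cong (WGraph.ω H) (separate∘unite c) i ⟩
        weight (WGraph.ω H) κ i                       ≡⟨ mono i ⟩
        m i ∎

    separate-cong : ∀ {κ κ′} → κ ≈ κ′ → separate κ ≈′ separate κ′
    separate-cong {κ} {κ′} κ≈κ′ zero    i = cong₂ _∧_ (κ≈κ′ v i) (κ≈κ′ w i)
    separate-cong {κ} {κ′} κ≈κ′ (suc u) i with position v w u
    ... | at-v = trans (separate-v κ i) (trans (cong₂ (λ x y → x ∧ not y) (κ≈κ′ v i) (κ≈κ′ w i)) (sym (separate-v κ′ i)))
    ... | at-w = trans (separate-w κ i) (trans (cong₂ (λ x y → x ∧ not y) (κ≈κ′ w i) (κ≈κ′ v i)) (sym (separate-w κ′ i)))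
    ... | elsewhere u≢v u≢w =
      trans (separate-other κ u≢v u≢w i) (trans (κ≈κ′ u i) (sym (separate-other κ′ u≢v u≢w i)))

    unite-cong : ∀ {κ κ′} → κ ≈′ κ′ → unite κ ≈ unite κ′
    unite-cong {κ} {κ′} κ≈κ′ u i with position v w u
    ... | at-v = trans (unite-v κ i) (trans (cong₂ _∨_ (κ≈κ′ (suc v) i) (κ≈κ′ zero i)) (sym (unite-v κ′ i)))
    ... | at-w = trans (unite-w κ i) (trans (cong₂ _∨_ (κ≈κ′ (suc w) i) (κ≈κ′ zero i)) (sym (unite-w κ′ i)))
    ... | elsewhere u≢v u≢w =
      trans (unite-other κ u≢v u≢w i) (trans (κ≈κ′ (suc u) i) (sym (unite-other κ′ u≢v u≢w i)))

    inverse : InverseOn (Colorings (suc k) N) (Colorings (suc (suc k)) N) Case (Contributes H m)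
    inverse = record
      { to        = separate
      ; from      = unite
      ; to-cong   = separate-cong
      ; from-cong = unite-cong
      ; to-∈      = separate-∈
      ; from-∈    = unite-∈
      ; from∘to   = λ {κ} _ → unite∘separate κ
      ; to∘from   = separate∘unite
      }

    count-case : count case? Cols ≡ count (contributes? H m) (allColorings (n H) N)
    count-case = count-InverseOn (Colorings (suc k) N) (Colorings (suc (suc k)) N) case? (contributes? H m)
      Case-resp (Contributes-resp H) inverse {Cols} {allColorings (suc (suc k)) N}
      (allColorings-enumerates (suc k) N) (allColorings-enumerates (suc (suc k)) N)
      where
      Case-resp : Case Respects _≈_
      Case-resp κ≈κ′ (((c , ¬sep) , ¬vw) , ¬wv) =
        ((Contributes-resp G κ≈κ′ c , ¬sep ∘ Separated-resp v w (≈-sym κ≈κ′)) , ¬vw ∘ Nested-resp v w (≈-sym κ≈κ′)) ,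
        ¬wv ∘ Nested-resp w v (≈-sym κ≈κ′)

  module _ (v w : Fin (suc k)) (v≢w : v ≢ w) (v≁w : adj v w ≡ false) where
    private
      module O = Ops (suc k) adj ω v w
      module G¹ = StrictlyNested v w v≢w O.pairvw (pairvw-elim v w) (pairvw-vw v w) (ω v + ω w) refl
      module G² = StrictlyNested w v (v≢w ∘ sym) O.pairvw (Sum.swap ∘ pairvw-elim v w) (pairvw-wv v w)
                                 (ω v + ω w) (+-comm (ω v) (ω w))
      module Ct = Contraction v w v≢w
      module X = Crossing v w v≢w v≁w

      C? : Decidable (Contributes G m)
      C? = contributes? G m
      C∖S? : Decidable (Contributes G m ∩ ∁ (Separated v w))
      C∖S? = C? ∩? ∁? (separated? v w)

      count-Xcoeff : ∀ {P : Pred (Coloring (suc k) N) 0ℓ} {P? : Decidable P} (H : WGraph) →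
                     count P? Cols ≡ count (contributes? H m) (allColorings (n H) N) → count P? Cols ≡ Xcoeff H N m
      count-Xcoeff H eq = trans eq (sym (Xcoeff≡count H m))

      union-case : count (C? ∩? separated? v w) Cols ≡ Xcoeff O.unionE N m
      union-case = count-Xcoeff O.unionE
        (count-cong (C? ∩? separated? v w) (contributes? O.unionE m) Cols (separated⇔unionE v w))

      G²-case : count ((C∖S? ∩? ∁? (nested? v w)) ∩? nested? w v) Cols ≡ Xcoeff O.G2 N m
      G²-case = count-Xcoeff O.G2 (trans (count-cong _ G².case? Cols (λ κ → mk⇔ swap-wv swap-vw)) G².count-case)
        where
        swap-wv : ∀ {κ} → (((Contributes G m ∩ ∁ (Separated v w)) ∩ ∁ (Nested v w)) ∩ Nested w v) κ → G².Case κ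
        swap-wv (((c , ¬sep) , ¬vw) , wv) = ((c , ¬sep ∘ Disjoint-sym) , wv) , ¬vw
        swap-vw : ∀ {κ} → G².Case κ → (((Contributes G m ∩ ∁ (Separated v w)) ∩ ∁ (Nested v w)) ∩ Nested w v) κ
        swap-vw (((c , ¬sep) , wv) , ¬vw) = ((c , ¬sep ∘ Disjoint-sym) , ¬vw) , wv

    Xcoeff-split : Xcoeff G N m ≡ Xcoeff (contract k adj ω v w) N m + Xcoeff O.unionE N m
                                          + Xcoeff O.G1 N m + Xcoeff O.G2 N m + Xcoeff O.Gstar N m
    Xcoeff-split = begin
      Xcoeff G N m
        ≡⟨ Xcoeff≡count G m ⟩
      count C? Cols
        ≡⟨ count-split₃ C? (separated? v w) (nested? v w) (nested? w v) Cols ⟩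
      count (C? ∩? separated? v w) Cols
        + ((count Ct.case? Cols + count G¹.case? Cols)
          + (count ((C∖S? ∩? ∁? (nested? v w)) ∩? nested? w v) Cols + count X.case? Cols))
        ≡⟨ cong₂ _+_ union-case (cong₂ _+_ (cong₂ _+_ (count-Xcoeff Ct.H Ct.count-case) (count-Xcoeff G¹.H G¹.count-case))
                                          (cong₂ _+_ G²-case (count-Xcoeff X.H X.count-case))) ⟩
      Xcoeff O.unionE N m + ((Xcoeff Ct.H N m + Xcoeff O.G1 N m) + (Xcoeff O.G2 N m + Xcoeff O.Gstar N m))
        ≡⟨ rearrange (Xcoeff O.unionE N m) (Xcoeff Ct.H N m) (Xcoeff O.G1 N m) (Xcoeff O.G2 N m) (Xcoeff O.Gstar N m) ⟩
      Xcoeff Ct.H N m + Xcoeff O.unionE N m + Xcoeff O.G1 N m + Xcoeff O.G2 N m + Xcoeff O.Gstar N m ∎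
      where
      rearrange : ∀ u c g₁ g₂ s → u + ((c + g₁) + (g₂ + s)) ≡ c + u + g₁ + g₂ + s
      rearrange = solve-∀

proposition3p6 : (k : ℕ) (adj : Fin (suc k) → Fin (suc k) → Bool) (ω : Fin (suc k) → ℕ)
    → (∀ a b → adj a b ≡ adj b a)
    → (∀ a → adj a a ≡ false)
    → (∀ u → 1 ≤ ω u)
    → (v w : Fin (suc k)) → v ≢ w → adj v w ≡ false
    → (N : ℕ) (m : Fin N → ℕ)
    → Xcoeff (wgraph (suc k) adj ω) N m
      ≡ Xcoeff (contract k adj ω v w) N m
        + Xcoeff (Ops.unionE (suc k) adj ω v w) N m
        + Xcoeff (Ops.G1 (suc k) adj ω v w) N m
        + Xcoeff (Ops.G2 (suc k) adj ω v w) N m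
        + Xcoeff (Ops.Gstar (suc k) adj ω v w) N m
proposition3p6 k adj ω adj-sym adj-irr _ v w v≢w v≁w N m =
  SplitByOverlap.Xcoeff-split k adj ω adj-sym adj-irr m v w v≢w v≁w
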